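{- Let $k\ge 1$ and $n\ge 1$ be integers, let $t_1,\dots,t_k$ be variables (or integers), with the convention $t_j=0$ for $j>k$, and let $\omega=(\omega_1,\omega_2,\dots)$ be a sequence of integers. Let $H_{+}$ be the $n\times n$ matrix $(h_{ij})$ with, for $1\le i\le n-1$: $h_{ij}=t_{i-j+1}$ if $j\le i$, $h_{i,i+1}=1$, and $h_{ij}=0$ if $j>i+1$; and with last row $h_{nj}=\omega_{n-j+1}t_{n-j+1}$ for $1\le j\le n$. That is, $$H_{+}=\begin{pmatrix} t_1 & 1 & 0 & \cdots & 0\\ t_2 & t_1 & 1 & \cdots & 0\\ \vdots & \vdots & \vdots & \ddots & \vdots\\ t_{n-1} & t_{n-2} & t_{n-3} & \cdots & 1\\ \omega_n t_n & \omega_{n-1}t_{n-1} & \omega_{n-2}t_{n-2} & \cdots & \omega_1 t_1\end{pmatrix}.$$ Let $H_{ - }$ be the same matrix except that every super-diagonal entry $1$ is replaced by $-1$. Then (a) $\operatorname{perm} H_{+}=P_{\omega,k,n}(t_1,\dots,t_k)$, and (b) $\det H_{ - }=P_{\omega,k,n}(t_1,\dots,t_k)$.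
   Context: The permanent of a square matrix $M=(m_{ij})_{1\le i,j\le n}$ is $\operatorname{perm}M=\sum_{\sigma\in S_n}\prod_{i=1}^n m_{i\sigma(i)}$. The weighted isobaric polynomial of isobaric degree $n$ with weight vector $\omega$ is $$P_{\omega,k,n}(t_1,\dots,t_k)=\sum_{\alpha}\binom{|\alpha|}{\alpha_1,\dots,\alpha_k}\frac{\sum_{j=1}^k\omega_j\alpha_j}{|\alpha|}\,t_1^{\alpha_1}\cdots t_k^{\alpha_k},$$ where the sum runs over all $\alpha=(\alpha_1,\dots,\alpha_k)\in\mathbb{Z}_{\ge0}^k$ with $\sum_{j=1}^k j\alpha_j=n$, $|\alpha|=\alpha_1+\cdots+\alpha_k$, and $\binom{|\alpha|}{\alpha_1,\dots,\alpha_k}$ is the multinomial coefficient. -}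

module Defs where

open import Data.Bool using (Bool; true; false; if_then_else_; not; _∧_)
open import Data.Nat as ℕ using (ℕ; zero; suc; _∸_; _!; _≡ᵇ_; _<ᵇ_)
open import Data.Fin as Fin using (Fin; toℕ; fromℕ<)
open import Data.Fin.Properties using () renaming (_≟_ to _≟ᶠ_)
open import Data.Integer as ℤ using (ℤ; +_)
open import Data.Rational as ℚ using (ℚ; 0ℚ; 1ℚ)
open import Data.List as List using (List; []; _∷_; concatMap; upTo; allFin; filterᵇ)
open import Data.Vec as Vec using (Vec; []; _∷_; lookup; tabulate)
open import Relation.Nullary.Decidable using (⌊_⌋; does; yes; no)
open import Data.Bool.ListAction using (and)
open import Data.Nat.ListAction using () renaming (product to ℕprod)
open import Data.Product using (_×_; _,_)

sumℤ : List ℤ → ℤ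
sumℤ = List.foldr ℤ._+_ (+ 0)

sumℚ : List ℚ → ℚ
sumℚ = List.foldr ℚ._+_ 0ℚ

prodℤ : {m : ℕ} → Vec ℤ m → ℤ
prodℤ = Vec.foldr _ ℤ._*_ (+ 1)

toℚ : ℤ → ℚ
toℚ z = z ℚ./ 1

-- a / d in ℚ; the case d = 0 never arises in the statement (|α| ≥ 1 since n ≥ 1,
-- and a product of factorials is ≥ 1); it is set to 0 only to make the function total.
divq : ℤ → ℕ → ℚ
divq a zero    = 0ℚ
divq a (suc d) = a ℚ./ suc d

-- Permutations of Fin n, enumerated as all injective maps Fin n → Fin n
-- (represented as vectors σ with σ i = lookup σ i).

allVecs : (n m : ℕ) → List (Vec (Fin n) m)
allVecs n zero    = [] ∷ []
allVecs n (suc m) = concatMap (λ x → List.map (x ∷_) (allVecs n m)) (allFin n)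

pairsLt : (n : ℕ) → List (Fin n × Fin n)
pairsLt n = concatMap (λ i → List.map (i ,_) (filterᵇ (λ j → toℕ i <ᵇ toℕ j) (allFin n))) (allFin n)

isPerm : {n : ℕ} → Vec (Fin n) n → Bool
isPerm {n} σ = and (List.map (λ { (i , j) → not ⌊ lookup σ i ≟ᶠ lookup σ j ⌋ }) (pairsLt n))

Sym : (n : ℕ) → List (Vec (Fin n) n)
Sym n = filterᵇ isPerm (allVecs n n)

inversions : {n : ℕ} → Vec (Fin n) n → ℕ
inversions {n} σ = List.length (filterᵇ (λ { (i , j) → toℕ (lookup σ j) <ᵇ toℕ (lookup σ i) }) (pairsLt n))

sign : {n : ℕ} → Vec (Fin n) n → ℤ
sign σ = (ℤ.- (+ 1)) ℤ.^ inversions σ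

diagProd : {n : ℕ} → (Fin n → Fin n → ℤ) → Vec (Fin n) n → ℤ
diagProd M σ = prodℤ (tabulate (λ i → M i (lookup σ i)))

perm : {n : ℕ} → (Fin n → Fin n → ℤ) → ℤ
perm {n} M = sumℤ (List.map (diagProd M) (Sym n))

det : {n : ℕ} → (Fin n → Fin n → ℤ) → ℤ
det {n} M = sumℤ (List.map (λ σ → sign σ ℤ.* diagProd M σ) (Sym n))

-- The variables.  t : Fin k → ℤ with  t_j = t (j-1)  for 1 ≤ j ≤ k,
-- extended by  t_j = 0  for j > k (and for the unused index j = 0).

tExt : {k : ℕ} → (Fin k → ℤ) → ℕ → ℤ
tExt {k} t zero = + 0
tExt {k} t (suc m) with m ℕ.<? k
... | yes p = t (fromℕ< p)
... | no _  = + 0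

-- Weights: ω_j = ω j for j ≥ 1 (the value ω 0 is never used).

-- The matrix H_s (1-based indices a = i+1, b = j+1); s = 1 gives H₊, s = -1 gives H₋.
H : (s : ℤ) (ω : ℕ → ℤ) {k : ℕ} (t : Fin k → ℤ) (n : ℕ) → Fin n → Fin n → ℤ
H s ω t n i j =
  if a ≡ᵇ n then ω (suc n ∸ b) ℤ.* tExt t (suc n ∸ b)
  else if b ℕ.≤ᵇ a then tExt t (suc a ∸ b)
  else if b ≡ᵇ suc a then s
  else + 0
  where
    a b : ℕ
    a = suc (toℕ i)
    b = suc (toℕ j)

Hplus : (ω : ℕ → ℤ) {k : ℕ} (t : Fin k → ℤ) (n : ℕ) → Fin n → Fin n → ℤ
Hplus = H (+ 1)

Hminus : (ω : ℕ → ℤ) {k : ℕ} (t : Fin k → ℤ) (n : ℕ) → Fin n → Fin n → ℤ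
Hminus = H (ℤ.- (+ 1))

-- Weighted isobaric polynomial P_{ω,k,n}(t_1,…,t_k), evaluated in ℚ.
-- α = (α_1,…,α_k) is a Vec ℕ k with α_j = lookup α (j-1).

-- all α ∈ {0,…,n}^k  (every α with Σ j α_j = n lies in this box)
box : (k n : ℕ) → List (Vec ℕ k)
box zero    n = [] ∷ []
box (suc k) n = concatMap (λ a → List.map (a ∷_) (box k n)) (upTo (suc n))

isoDeg : {k : ℕ} → Vec ℕ k → ℕ
isoDeg {k} α = Vec.sum (tabulate (λ j → suc (toℕ j) ℕ.* lookup α j))

Alphas : (k n : ℕ) → List (Vec ℕ k)
Alphas k n = filterᵇ (λ α → isoDeg α ≡ᵇ n) (box k n)

norm : {k : ℕ} → Vec ℕ k → ℕ
norm α = Vec.sum α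

multinomial : {k : ℕ} → Vec ℕ k → ℚ
multinomial α = divq (+ (norm α !)) (ℕprod (List.map _! (Vec.toList α)))

weightSum : (ω : ℕ → ℤ) {k : ℕ} → Vec ℕ k → ℤ
weightSum ω {k} α = sumℤ (List.map (λ j → ω (suc (toℕ j)) ℤ.* (+ lookup α j)) (allFin k))

monomial : {k : ℕ} → (Fin k → ℤ) → Vec ℕ k → ℤ
monomial t α = prodℤ (tabulate (λ j → t j ℤ.^ lookup α j))

P : (ω : ℕ → ℤ) (k n : ℕ) (t : Fin k → ℤ) → ℚ
P ω k n t = sumℚ (List.map
  (λ α → multinomial α ℚ.* divq (weightSum ω α) (norm α) ℚ.* toℚ (monomial t α))
  (Alphas k n))

module Submission where

-- A permutation contributing to the permanent of a Hessenberg matrix sends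
-- each row r either to r + 1 or to the one value ≤ r that earlier rows left unused (the
-- gap).  Summing row by row, the result depends only on how far the gap lags behind,
-- and gives the convolution recursion
--   Q(e + 1) = ω_{e+1} t_{e+1} + Σ_{i ≤ e} t_{i+1} Q(e − i),   Q(0) = 0,
-- for Q(n) = perm H₊.  In det H₋ every superdiagonal −1 is matched by exactly one
-- inversion of the permutation, so det H₋ = perm H₊.  On the other side, the coefficient
-- multinomial(α) · (Σⱼ ωⱼ αⱼ) / |α| is the integer Σⱼ ωⱼ · multinomial(α − eⱼ), and
-- splitting off one variable tⱼ shows that P_{ω,k,n} satisfies the same recursion.

open import Defs
import Algebra.Properties.CommutativeSemigroup as CommSemigroupProperties
open import Data.Bool using (Bool; true; false; if_then_else_; not; _∧_; _∨_)
open import Data.Bool.Properties as BP using (if-eta; T-≡)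
open import Data.Bool.ListAction using (and)
open import Data.Empty using (⊥-elim)
open import Data.Fin as Fin using (Fin; toℕ)
open import Data.Fin.Properties as FinP using () renaming (_≟_ to _≟ᶠ_)
open import Data.Integer as ℤ using (ℤ; +_; _+_; _*_; -_; _^_)
open import Data.Integer.Properties as ℤP using ()
open import Data.Integer.Tactic.RingSolver using (solve-∀)
open import Data.List as List using (List; []; _∷_; _++_; map; concatMap; filterᵇ; applyUpTo; length; allFin; upTo)
open import Data.List.Properties as LP using ()
open import Data.Nat as ℕ using (ℕ; zero; suc; pred; _∸_; _!; _≤_; _<_; z≤n; s≤s; _≡ᵇ_; _<ᵇ_; _≤ᵇ_)
open import Data.Nat.Induction using (<-rec)
open import Data.Nat.ListAction using () renaming (product to ℕprod)
open import Data.Nat.Properties as NP using ()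
import Data.Nat.Tactic.RingSolver as ℕSolver
open import Data.Product using (Σ; _×_; _,_; proj₁; proj₂)
open import Data.Rational as ℚ using (ℚ)
open import Data.Rational.Properties as ℚP using ()
open import Data.Rational.Unnormalised as ℚᵘ using (mkℚᵘ; *≡*)
open import Data.Rational.Unnormalised.Properties as ℚᵘP using ()
open import Data.Sum using (_⊎_; inj₁; inj₂)
open import Data.Vec as Vec using (Vec; []; _∷_; lookup)
open import Function using (_∘_; Equivalence)
open import Relation.Nullary using (¬_; Dec; yes; no)
open import Relation.Nullary.Decidable using (⌊_⌋)
open import Relation.Binary.PropositionalEquality
open ≡-Reasoning

module ℕ* = CommSemigroupProperties NP.*-commutativeSemigroup
module ℤ* = CommSemigroupProperties ℤP.*-commutativeSemigroup
module ℤ+ = CommSemigroupProperties ℤP.+-commutativeSemigroup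

sumℤ-++ : (xs ys : List ℤ) → sumℤ (xs ++ ys) ≡ sumℤ xs + sumℤ ys
sumℤ-++ [] ys = sym (ℤP.+-identityˡ _)
sumℤ-++ (x ∷ xs) ys = trans (cong (_+_ x) (sumℤ-++ xs ys)) (sym (ℤP.+-assoc x _ _))

sumℤ-concatMap : {A B : Set} (f : B → ℤ) (g : A → List B) (xs : List A) →
  sumℤ (map f (concatMap g xs)) ≡ sumℤ (map (λ x → sumℤ (map f (g x))) xs)
sumℤ-concatMap f g [] = refl
sumℤ-concatMap f g (x ∷ xs) = begin
  sumℤ (map f (g x ++ concatMap g xs))          ≡⟨ cong sumℤ (LP.map-++ f (g x) _) ⟩
  sumℤ (map f (g x) ++ map f (concatMap g xs))  ≡⟨ sumℤ-++ (map f (g x)) _ ⟩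
  _                                             ≡⟨ cong (_+_ (sumℤ (map f (g x)))) (sumℤ-concatMap f g xs) ⟩
  _                                             ∎

sumℤ-map-∘ : {A B : Set} (f : B → ℤ) (g : A → B) (xs : List A) →
  sumℤ (map f (map g xs)) ≡ sumℤ (map (f ∘ g) xs)
sumℤ-map-∘ f g xs = cong sumℤ (sym (LP.map-∘ xs))

sumℤ-filterᵇ : {A : Set} (p : A → Bool) (f : A → ℤ) (xs : List A) →
  sumℤ (map f (filterᵇ p xs)) ≡ sumℤ (map (λ x → if p x then f x else + 0) xs)
sumℤ-filterᵇ p f [] = refl
sumℤ-filterᵇ p f (x ∷ xs) with p x
... | true  = cong (_+_ (f x)) (sumℤ-filterᵇ p f xs)
... | false = sym (trans (ℤP.+-identityˡ _) (sym (sumℤ-filterᵇ p f xs)))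

sumℤ-cong : {A : Set} {f g : A → ℤ} → (∀ x → f x ≡ g x) → (xs : List A) →
  sumℤ (map f xs) ≡ sumℤ (map g xs)
sumℤ-cong f≡g xs = cong sumℤ (LP.map-cong f≡g xs)

sumℤ-zero : {A : Set} (f : A → ℤ) → (∀ x → f x ≡ + 0) → (xs : List A) → sumℤ (map f xs) ≡ + 0
sumℤ-zero f f≡0 [] = refl
sumℤ-zero f f≡0 (x ∷ xs) rewrite f≡0 x | sumℤ-zero f f≡0 xs = refl

sumℤ-+ : {A : Set} (f g : A → ℤ) (xs : List A) →
  sumℤ (map (λ x → f x + g x) xs) ≡ sumℤ (map f xs) + sumℤ (map g xs)
sumℤ-+ f g [] = refl
sumℤ-+ f g (x ∷ xs) rewrite sumℤ-+ f g xs = ℤ+.interchange (f x) (g x) _ _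

sumℤ-*ˡ : {A : Set} (c : ℤ) (f : A → ℤ) (xs : List A) →
  sumℤ (map (λ x → c * f x) xs) ≡ c * sumℤ (map f xs)
sumℤ-*ˡ c f [] = sym (ℤP.*-zeroʳ c)
sumℤ-*ˡ c f (x ∷ xs) rewrite sumℤ-*ˡ c f xs = sym (ℤP.*-distribˡ-+ c (f x) _)

sumℤ-*ʳ : {A : Set} (c : ℤ) (f : A → ℤ) (xs : List A) →
  sumℤ (map (λ x → f x * c) xs) ≡ sumℤ (map f xs) * c
sumℤ-*ʳ c f xs = begin
  sumℤ (map (λ x → f x * c) xs) ≡⟨ sumℤ-cong (λ x → ℤP.*-comm (f x) c) xs ⟩
  sumℤ (map (λ x → c * f x) xs) ≡⟨ sumℤ-*ˡ c f xs ⟩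
  c * sumℤ (map f xs)           ≡⟨ ℤP.*-comm c _ ⟩
  sumℤ (map f xs) * c           ∎

sumℤ-swap : {A B : Set} (f : A → B → ℤ) (xs : List A) (ys : List B) →
  sumℤ (map (λ x → sumℤ (map (f x) ys)) xs) ≡ sumℤ (map (λ y → sumℤ (map (λ x → f x y) xs)) ys)
sumℤ-swap f [] ys = sym (sumℤ-zero _ (λ _ → refl) ys)
sumℤ-swap f (x ∷ xs) ys =
  trans (cong (_+_ (sumℤ (map (f x) ys))) (sumℤ-swap f xs ys)) (sym (sumℤ-+ (f x) _ ys))

sumℤ-if : {A : Set} (b : Bool) (f : A → ℤ) (xs : List A) →
  sumℤ (map (λ x → if b then f x else + 0) xs) ≡ (if b then sumℤ (map f xs) else + 0)
sumℤ-if true  f xs = refl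
sumℤ-if false f xs = sumℤ-zero _ (λ _ → refl) xs

sumBelow : (ℕ → ℤ) → ℕ → ℤ
sumBelow f zero    = + 0
sumBelow f (suc n) = f 0 + sumBelow (f ∘ suc) n

sumℤ-applyUpTo : (h : ℕ → ℤ) (g : ℕ → ℕ) (n : ℕ) → sumℤ (map h (applyUpTo g n)) ≡ sumBelow (h ∘ g) n
sumℤ-applyUpTo h g zero    = refl
sumℤ-applyUpTo h g (suc n) = cong (_+_ (h (g 0))) (sumℤ-applyUpTo h (g ∘ suc) n)

sumBelow-cong : (f g : ℕ → ℤ) (n : ℕ) → (∀ i → i < n → f i ≡ g i) → sumBelow f n ≡ sumBelow g n
sumBelow-cong f g zero    f≡g = refl
sumBelow-cong f g (suc n) f≡g =
  cong₂ _+_ (f≡g 0 (s≤s z≤n)) (sumBelow-cong (f ∘ suc) (g ∘ suc) n (λ i i<n → f≡g (suc i) (s≤s i<n)))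

sumBelow-snoc : (f : ℕ → ℤ) (n : ℕ) → sumBelow f (suc n) ≡ sumBelow f n + f n
sumBelow-snoc f zero    = trans (ℤP.+-identityʳ (f 0)) (sym (ℤP.+-identityˡ (f 0)))
sumBelow-snoc f (suc n) = trans (cong (_+_ (f 0)) (sumBelow-snoc (f ∘ suc) n)) (sym (ℤP.+-assoc (f 0) _ _))

sumBelow-zero : (f : ℕ → ℤ) (n : ℕ) → (∀ i → i < n → f i ≡ + 0) → sumBelow f n ≡ + 0
sumBelow-zero f zero    f≡0 = refl
sumBelow-zero f (suc n) f≡0 =
  trans (cong₂ _+_ (f≡0 0 (s≤s z≤n)) (sumBelow-zero (f ∘ suc) n (λ i i<n → f≡0 (suc i) (s≤s i<n))))
        (ℤP.+-identityˡ _)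

sumBelow-tail : (f : ℕ → ℤ) (b c : ℕ) → (∀ i → b ≤ i → f i ≡ + 0) → sumBelow f (b ℕ.+ c) ≡ sumBelow f b
sumBelow-tail f zero    c f≡0 = sumBelow-zero f c (λ i _ → f≡0 i z≤n)
sumBelow-tail f (suc b) c f≡0 = cong (_+_ (f 0)) (sumBelow-tail (f ∘ suc) b c (λ i b≤i → f≡0 (suc i) (s≤s b≤i)))

sumBelow-+ : (f g : ℕ → ℤ) (n : ℕ) → sumBelow (λ i → f i + g i) n ≡ sumBelow f n + sumBelow g n
sumBelow-+ f g zero = refl
sumBelow-+ f g (suc n) rewrite sumBelow-+ (f ∘ suc) (g ∘ suc) n = ℤ+.interchange (f 0) (g 0) _ _

tabulate-suc : (m : ℕ) → List.tabulate {n = m} Fin.suc ≡ map Fin.suc (allFin m)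
tabulate-suc m = sym (LP.map-tabulate (λ i → i) Fin.suc)

filterᵇ-map : {A B : Set} (p : B → Bool) (g : A → B) (xs : List A) →
  filterᵇ p (map g xs) ≡ map g (filterᵇ (p ∘ g) xs)
filterᵇ-map p g [] = refl
filterᵇ-map p g (x ∷ xs) with p (g x)
... | true  = cong (g x ∷_) (filterᵇ-map p g xs)
... | false = filterᵇ-map p g xs

filterᵇ-all : {A : Set} (p : A → Bool) (xs : List A) → (∀ x → p x ≡ true) → filterᵇ p xs ≡ xs
filterᵇ-all p [] _ = refl
filterᵇ-all p (x ∷ xs) all-p with p x | all-p x
... | true | _ = cong (x ∷_) (filterᵇ-all p xs all-p)

length-filterᵇ-map : {A B : Set} (p : B → Bool) (g : A → B) (xs : List A) →
  length (filterᵇ p (map g xs)) ≡ length (filterᵇ (p ∘ g) xs)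
length-filterᵇ-map p g xs = trans (cong length (filterᵇ-map p g xs)) (LP.length-map g (filterᵇ (p ∘ g) xs))

length-filterᵇ-++ : {A : Set} (p : A → Bool) (xs ys : List A) →
  length (filterᵇ p (xs ++ ys)) ≡ length (filterᵇ p xs) ℕ.+ length (filterᵇ p ys)
length-filterᵇ-++ p xs ys = trans (cong length (LP.filter-++ _ xs ys)) (LP.length-++ (filterᵇ p xs))

and-++ : (xs ys : List Bool) → and (xs ++ ys) ≡ and xs ∧ and ys
and-++ [] ys = refl
and-++ (true  ∷ xs) ys = and-++ xs ys
and-++ (false ∷ xs) ys = refl

sucPair : {m : ℕ} → Fin m × Fin m → Fin (suc m) × Fin (suc m)
sucPair (i , j) = (Fin.suc i , Fin.suc j)

pairsLt-suc : (m : ℕ) → pairsLt (suc m) ≡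
  map (λ j → (Fin.zero , Fin.suc j)) (allFin m) ++ map sucPair (pairsLt m)
pairsLt-suc m = cong₂ _++_ firstRow laterRows
  where
  A = allFin m
  _≺_ : {N : ℕ} → Fin N → Fin N → Bool
  i ≺ j = toℕ i <ᵇ toℕ j
  later : Fin (suc m) → List (Fin (suc m) × Fin (suc m))
  later i = map (i ,_) (filterᵇ (i ≺_) (allFin (suc m)))
  firstRow : map (Fin.zero ,_) (filterᵇ (Fin.zero ≺_) (List.tabulate Fin.suc))
           ≡ map (λ j → (Fin.zero , Fin.suc j)) A
  firstRow = begin
    map (Fin.zero ,_) (filterᵇ (Fin.zero ≺_) (List.tabulate Fin.suc))
      ≡⟨ cong (λ z → map (Fin.zero ,_) (filterᵇ (Fin.zero ≺_) z)) (tabulate-suc m) ⟩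
    map (Fin.zero ,_) (filterᵇ (Fin.zero ≺_) (map Fin.suc A))
      ≡⟨ cong (map (Fin.zero ,_)) (filterᵇ-map (Fin.zero ≺_) Fin.suc A) ⟩
    map (Fin.zero ,_) (map Fin.suc (filterᵇ (λ _ → true) A))
      ≡⟨ cong (map (Fin.zero ,_) ∘ map Fin.suc) (filterᵇ-all _ A (λ _ → refl)) ⟩
    map (Fin.zero ,_) (map Fin.suc A)
      ≡⟨ sym (LP.map-∘ A) ⟩
    map (λ j → (Fin.zero , Fin.suc j)) A ∎
  laterRow : ∀ i → later (Fin.suc i) ≡ map sucPair (map (i ,_) (filterᵇ (i ≺_) A))
  laterRow i = begin
    map (Fin.suc i ,_) (filterᵇ (Fin.suc i ≺_) (List.tabulate Fin.suc))
      ≡⟨ cong (λ z → map (Fin.suc i ,_) (filterᵇ (Fin.suc i ≺_) z)) (tabulate-suc m) ⟩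
    map (Fin.suc i ,_) (filterᵇ (Fin.suc i ≺_) (map Fin.suc A))
      ≡⟨ cong (map (Fin.suc i ,_)) (filterᵇ-map (Fin.suc i ≺_) Fin.suc A) ⟩
    map (Fin.suc i ,_) (map Fin.suc (filterᵇ (i ≺_) A))
      ≡⟨ sym (LP.map-∘ _) ⟩
    map (λ j → (Fin.suc i , Fin.suc j)) (filterᵇ (i ≺_) A)
      ≡⟨ LP.map-∘ _ ⟩
    map sucPair (map (i ,_) (filterᵇ (i ≺_) A)) ∎
  laterRows : concatMap later (List.tabulate Fin.suc) ≡ map sucPair (pairsLt m)
  laterRows = begin
    concatMap later (List.tabulate Fin.suc) ≡⟨ cong (concatMap later) (tabulate-suc m) ⟩
    concatMap later (map Fin.suc A)         ≡⟨ LP.concatMap-map later Fin.suc A ⟩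
    concatMap (later ∘ Fin.suc) A           ≡⟨ cong List.concat (LP.map-cong laterRow A) ⟩
    concatMap (λ i → map sucPair (map (i ,_) (filterᵇ (i ≺_) A))) A
                                            ≡⟨ sym (LP.map-concatMap sucPair _ A) ⟩
    map sucPair (pairsLt m)                 ∎

allᵇ : {A : Set} {m : ℕ} → (A → Bool) → Vec A m → Bool
allᵇ p []      = true
allᵇ p (y ∷ σ) = p y ∧ allᵇ p σ

countᵇ : {A : Set} {m : ℕ} → (A → Bool) → Vec A m → ℕ
countᵇ p []      = 0
countᵇ p (y ∷ σ) = (if p y then 1 else 0) ℕ.+ countᵇ p σ

notElemᵇ : {N m : ℕ} → Fin N → Vec (Fin N) m → Bool
notElemᵇ x σ = allᵇ (λ y → not ⌊ x ≟ᶠ y ⌋) σ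

injectiveᵇ : {N m : ℕ} → Vec (Fin N) m → Bool
injectiveᵇ []      = true
injectiveᵇ (x ∷ σ) = notElemᵇ x σ ∧ injectiveᵇ σ

inversionCount : {N m : ℕ} → Vec (Fin N) m → ℕ
inversionCount []      = 0
inversionCount (x ∷ σ) = countᵇ (λ y → toℕ y <ᵇ toℕ x) σ ℕ.+ inversionCount σ

and-map-lookup : {A : Set} {m : ℕ} (p : A → Bool) (σ : Vec A m) →
  and (map (λ j → p (lookup σ j)) (allFin m)) ≡ allᵇ p σ
and-map-lookup p [] = refl
and-map-lookup {m = suc m} p (y ∷ σ) rewrite tabulate-suc m =
  cong (p y ∧_) (trans (cong and (sym (LP.map-∘ (allFin m)))) (and-map-lookup p σ))

length-filterᵇ-lookup : {A : Set} {m : ℕ} (p : A → Bool) (σ : Vec A m) →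
  length (filterᵇ (λ j → p (lookup σ j)) (allFin m)) ≡ countᵇ p σ
length-filterᵇ-lookup p [] = refl
length-filterᵇ-lookup {m = suc m} p (y ∷ σ) rewrite tabulate-suc m with p y
... | true  = cong suc (trans (length-filterᵇ-map _ Fin.suc (allFin m)) (length-filterᵇ-lookup p σ))
... | false = trans (length-filterᵇ-map _ Fin.suc (allFin m)) (length-filterᵇ-lookup p σ)

-- isPerm and inversions of Defs, generalised to vectors of any length m so that they admit induction
pairwiseDistinctᵇ : {N m : ℕ} → Vec (Fin N) m → Bool
pairwiseDistinctᵇ {m = m} σ = and (map (λ { (i , j) → not ⌊ lookup σ i ≟ᶠ lookup σ j ⌋ }) (pairsLt m))

pairInversions : {N m : ℕ} → Vec (Fin N) m → ℕ
pairInversions {m = m} σ = length (filterᵇ (λ { (i , j) → toℕ (lookup σ j) <ᵇ toℕ (lookup σ i) }) (pairsLt m))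

pairwiseDistinct≡injective : {N m : ℕ} (σ : Vec (Fin N) m) → pairwiseDistinctᵇ σ ≡ injectiveᵇ σ
pairwiseDistinct≡injective [] = refl
pairwiseDistinct≡injective {m = suc m} (x ∷ σ) = begin
  and (map f (pairsLt (suc m)))                        ≡⟨ cong (λ z → and (map f z)) (pairsLt-suc m) ⟩
  and (map f (firstRow ++ map sucPair (pairsLt m)))    ≡⟨ cong and (LP.map-++ f firstRow _) ⟩
  and (map f firstRow ++ map f (map sucPair (pairsLt m)))
                                                       ≡⟨ and-++ (map f firstRow) _ ⟩
  and (map f firstRow) ∧ and (map f (map sucPair (pairsLt m)))
    ≡⟨ cong₂ _∧_ (trans (cong and (sym (LP.map-∘ (allFin m)))) (and-map-lookup (λ y → not ⌊ x ≟ᶠ y ⌋) σ))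
                 (trans (cong and (sym (LP.map-∘ (pairsLt m)))) (pairwiseDistinct≡injective σ)) ⟩
  notElemᵇ x σ ∧ injectiveᵇ σ                          ∎
  where
  f : Fin (suc m) × Fin (suc m) → Bool
  f (i , j) = not ⌊ lookup (x ∷ σ) i ≟ᶠ lookup (x ∷ σ) j ⌋
  firstRow = map (λ j → (Fin.zero , Fin.suc j)) (allFin m)

pairInversions≡inversionCount : {N m : ℕ} (σ : Vec (Fin N) m) → pairInversions σ ≡ inversionCount σ
pairInversions≡inversionCount [] = refl
pairInversions≡inversionCount {m = suc m} (x ∷ σ) = begin
  length (filterᵇ f (pairsLt (suc m)))                   ≡⟨ cong (λ z → length (filterᵇ f z)) (pairsLt-suc m) ⟩
  length (filterᵇ f (firstRow ++ map sucPair (pairsLt m))) ≡⟨ length-filterᵇ-++ f firstRow _ ⟩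
  length (filterᵇ f firstRow) ℕ.+ length (filterᵇ f (map sucPair (pairsLt m)))
    ≡⟨ cong₂ ℕ._+_ (trans (length-filterᵇ-map f _ (allFin m)) (length-filterᵇ-lookup (λ y → toℕ y <ᵇ toℕ x) σ))
                   (trans (length-filterᵇ-map f sucPair (pairsLt m)) (pairInversions≡inversionCount σ)) ⟩
  countᵇ (λ y → toℕ y <ᵇ toℕ x) σ ℕ.+ inversionCount σ   ∎
  where
  f : Fin (suc m) × Fin (suc m) → Bool
  f (i , j) = toℕ (lookup (x ∷ σ) j) <ᵇ toℕ (lookup (x ∷ σ) i)
  firstRow = map (λ j → (Fin.zero , Fin.suc j)) (allFin m)

∧-true-split : ∀ {a b} → a ∧ b ≡ true → (a ≡ true) × (b ≡ true)
∧-true-split {true} {true} _ = refl , refl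

∧-true-intro : ∀ {a b} → a ≡ true → b ≡ true → a ∧ b ≡ true
∧-true-intro refl refl = refl

Bool-ext : ∀ {a b : Bool} → (a ≡ true → b ≡ true) → (b ≡ true → a ≡ true) → a ≡ b
Bool-ext {true}  {true}  _ _ = refl
Bool-ext {true}  {false} f _ = sym (f refl)
Bool-ext {false} {true}  _ g = g refl
Bool-ext {false} {false} _ _ = refl

if-true : {A : Set} {b : Bool} {x y : A} → b ≡ true → (if b then x else y) ≡ x
if-true refl = refl

if-false : {A : Set} {b : Bool} {x y : A} → b ≡ false → (if b then x else y) ≡ y
if-false refl = refl

≡ᵇ-true : ∀ m n → m ≡ n → (m ≡ᵇ n) ≡ true
≡ᵇ-true m n m≡n = Equivalence.to T-≡ (NP.≡⇒≡ᵇ m n m≡n)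

≡ᵇ-false : ∀ m n → m ≢ n → (m ≡ᵇ n) ≡ false
≡ᵇ-false m n m≢n with m ≡ᵇ n in eq
... | true  = ⊥-elim (m≢n (NP.≡ᵇ⇒≡ m n (Equivalence.from T-≡ eq)))
... | false = refl

<ᵇ-true : ∀ m n → m < n → (m <ᵇ n) ≡ true
<ᵇ-true m n m<n = Equivalence.to T-≡ (NP.<⇒<ᵇ m<n)

<ᵇ-false : ∀ m n → ¬ (m < n) → (m <ᵇ n) ≡ false
<ᵇ-false m n m≮n with m <ᵇ n in eq
... | true  = ⊥-elim (m≮n (NP.<ᵇ⇒< m n (Equivalence.from T-≡ eq)))
... | false = refl

≤ᵇ-true : ∀ m n → m ≤ n → (m ≤ᵇ n) ≡ true
≤ᵇ-true m n m≤n = Equivalence.to T-≡ (NP.≤⇒≤ᵇ m≤n)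

≤ᵇ-false : ∀ m n → ¬ (m ≤ n) → (m ≤ᵇ n) ≡ false
≤ᵇ-false m n m≰n with m ≤ᵇ n in eq
... | true  = ⊥-elim (m≰n (NP.≤ᵇ⇒≤ m n (Equivalence.from T-≡ eq)))
... | false = refl

≟ᶠ-false : {n : ℕ} (x y : Fin n) → not ⌊ x ≟ᶠ y ⌋ ≡ true → toℕ x ≢ toℕ y
≟ᶠ-false x y _ x≡y with x ≟ᶠ y
... | no x≢y = x≢y (FinP.toℕ-injective x≡y)

≢⇒≟ᶠ-false : {n : ℕ} (x y : Fin n) → toℕ x ≢ toℕ y → not ⌊ x ≟ᶠ y ⌋ ≡ true
≢⇒≟ᶠ-false x y x≢y with x ≟ᶠ y
... | yes x≡y = ⊥-elim (x≢y (cong toℕ x≡y))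
... | no _    = refl

allᵇ-zip : {A : Set} {m : ℕ} {p q w : A → Bool} (σ : Vec A m) → allᵇ p σ ≡ true → allᵇ q σ ≡ true →
  (∀ y → p y ≡ true → q y ≡ true → w y ≡ true) → allᵇ w σ ≡ true
allᵇ-zip [] _ _ _ = refl
allᵇ-zip (y ∷ σ) all-p all-q pq⇒w with ∧-true-split all-p | ∧-true-split all-q
... | py , ps | qy , qs = ∧-true-intro (pq⇒w y py qy) (allᵇ-zip σ ps qs pq⇒w)

allᵇ-mono : {A : Set} {m : ℕ} {p w : A → Bool} (σ : Vec A m) → allᵇ p σ ≡ true →
  (∀ y → p y ≡ true → w y ≡ true) → allᵇ w σ ≡ true
allᵇ-mono σ all-p p⇒w = allᵇ-zip σ all-p all-p (λ y py _ → p⇒w y py)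

allᵇ-all : {A : Set} {m : ℕ} (p : A → Bool) (σ : Vec A m) → (∀ y → p y ≡ true) → allᵇ p σ ≡ true
allᵇ-all p []      _   = refl
allᵇ-all p (y ∷ σ) all = ∧-true-intro (all y) (allᵇ-all p σ all)

-- Permutations supported on a Hessenberg pattern

-- Rows 0 … r−1 of a permutation with σ(i) ≤ i + 1 use every value 0 … r except one,
-- the gap u; row r must then take either u (and the gap moves to r + 1) or r + 1.
hessenbergPermᵇ : {n m : ℕ} → ℕ → ℕ → Vec (Fin n) m → Bool
hessenbergPermᵇ r u [] = true
hessenbergPermᵇ r u (x ∷ σ) =
  if ⌊ toℕ x ℕ.≟ u ⌋ then hessenbergPermᵇ (suc r) (suc r) σ
  else if ⌊ toℕ x ℕ.≟ suc r ⌋ then hessenbergPermᵇ (suc r) u σ else false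

hessenbergShapeᵇ : {n m : ℕ} → ℕ → Vec (Fin n) m → Bool
hessenbergShapeᵇ r []      = true
hessenbergShapeᵇ r (x ∷ σ) = ⌊ toℕ x ℕ.≤? suc r ⌋ ∧ hessenbergShapeᵇ (suc r) σ

-- the values not yet used after row r − 1
unusedᵇ : {n : ℕ} → ℕ → ℕ → Fin n → Bool
unusedᵇ r u y = ⌊ toℕ y ℕ.≟ u ⌋ ∨ ⌊ r ℕ.<? toℕ y ⌋

module _ {n m : ℕ} (r u : ℕ) (x : Fin n) (σ : Vec (Fin n) m) where

  hessenbergPerm-gap : toℕ x ≡ u → hessenbergPermᵇ r u (x ∷ σ) ≡ hessenbergPermᵇ (suc r) (suc r) σ
  hessenbergPerm-gap x≡u with toℕ x ℕ.≟ u
  ... | yes _   = refl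
  ... | no x≢u  = ⊥-elim (x≢u x≡u)

  hessenbergPerm-next : toℕ x ≢ u → toℕ x ≡ suc r → hessenbergPermᵇ r u (x ∷ σ) ≡ hessenbergPermᵇ (suc r) u σ
  hessenbergPerm-next x≢u x≡r+1 with toℕ x ℕ.≟ u
  ... | yes x≡u = ⊥-elim (x≢u x≡u)
  ... | no _ with toℕ x ℕ.≟ suc r
  ...   | yes _ = refl
  ...   | no x≢r+1 = ⊥-elim (x≢r+1 x≡r+1)

  hessenbergPerm-other : toℕ x ≢ u → toℕ x ≢ suc r → hessenbergPermᵇ r u (x ∷ σ) ≡ false
  hessenbergPerm-other x≢u x≢r+1 with toℕ x ℕ.≟ u
  ... | yes x≡u = ⊥-elim (x≢u x≡u)
  ... | no _ with toℕ x ℕ.≟ suc r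
  ...   | yes x≡r+1 = ⊥-elim (x≢r+1 x≡r+1)
  ...   | no _ = refl

  hessenbergPerm-cases : hessenbergPermᵇ r u (x ∷ σ) ≡ true →
    ((toℕ x ≡ u) × (hessenbergPermᵇ (suc r) (suc r) σ ≡ true))
    ⊎ ((toℕ x ≢ u) × (toℕ x ≡ suc r) × (hessenbergPermᵇ (suc r) u σ ≡ true))
  hessenbergPerm-cases accept with toℕ x ℕ.≟ u
  ... | yes x≡u = inj₁ (x≡u , accept)
  ... | no x≢u with toℕ x ℕ.≟ suc r
  ...   | yes x≡r+1 = inj₂ (x≢u , x≡r+1 , accept)

  hessenbergShape-cases : hessenbergShapeᵇ r (x ∷ σ) ≡ true → (toℕ x ≤ suc r) × (hessenbergShapeᵇ (suc r) σ ≡ true)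
  hessenbergShape-cases shape with ∧-true-split {⌊ toℕ x ℕ.≤? suc r ⌋} shape
  ... | _ , rest with toℕ x ℕ.≤? suc r
  ...   | yes x≤r+1 = x≤r+1 , rest

module _ {n : ℕ} (r u : ℕ) (y : Fin n) where

  unused-cases : unusedᵇ r u y ≡ true → (toℕ y ≡ u) ⊎ (r < toℕ y)
  unused-cases _ with toℕ y ℕ.≟ u | r ℕ.<? toℕ y
  ... | yes y≡u | _     = inj₁ y≡u
  ... | no _    | yes r<y = inj₂ r<y

  unused-gap : toℕ y ≡ u → unusedᵇ r u y ≡ true
  unused-gap y≡u with toℕ y ℕ.≟ u
  ... | yes _   = refl
  ... | no y≢u  = ⊥-elim (y≢u y≡u)

  unused-beyond : r < toℕ y → unusedᵇ r u y ≡ true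
  unused-beyond r<y with r ℕ.<? toℕ y
  ... | yes _   = BP.∨-zeroʳ _
  ... | no r≮y  = ⊥-elim (r≮y r<y)

unused-initially : {n : ℕ} (y : Fin n) → unusedᵇ 0 0 y ≡ true
unused-initially y = byCase (toℕ y ℕ.≟ 0)
  where
  byCase : Dec (toℕ y ≡ 0) → unusedᵇ 0 0 y ≡ true
  byCase (yes y≡0) = unused-gap 0 0 y y≡0
  byCase (no y≢0)  = unused-beyond 0 0 y (NP.n≢0⇒n>0 y≢0)

hessenbergPerm⇒unused : {n m : ℕ} (r u : ℕ) (σ : Vec (Fin n) m) →
  hessenbergPermᵇ r u σ ≡ true → u ≤ r → allᵇ (unusedᵇ r u) σ ≡ true
hessenbergPerm⇒unused r u [] _ _ = refl
hessenbergPerm⇒unused r u (x ∷ σ) accept u≤r with hessenbergPerm-cases r u x σ accept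
... | inj₁ (x≡u , accept′) =
  ∧-true-intro (unused-gap r u x x≡u)
    (allᵇ-mono σ (hessenbergPerm⇒unused (suc r) (suc r) σ accept′ NP.≤-refl) shrink)
  where
  shrink : ∀ y → unusedᵇ (suc r) (suc r) y ≡ true → unusedᵇ r u y ≡ true
  shrink y unused with unused-cases (suc r) (suc r) y unused
  ... | inj₁ y≡r+1 = unused-beyond r u y (NP.≤-reflexive (sym y≡r+1))
  ... | inj₂ r+1<y = unused-beyond r u y (NP.<-trans (NP.n<1+n r) r+1<y)
... | inj₂ (_ , x≡r+1 , accept′) =
  ∧-true-intro (unused-beyond r u x (NP.≤-reflexive (sym x≡r+1)))
    (allᵇ-mono σ (hessenbergPerm⇒unused (suc r) u σ accept′ (NP.m≤n⇒m≤1+n u≤r)) shrink)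
  where
  shrink : ∀ y → unusedᵇ (suc r) u y ≡ true → unusedᵇ r u y ≡ true
  shrink y unused with unused-cases (suc r) u y unused
  ... | inj₁ y≡u     = unused-gap r u y y≡u
  ... | inj₂ r+1<y   = unused-beyond r u y (NP.<-trans (NP.n<1+n r) r+1<y)

hessenbergPerm⇒injective : {n m : ℕ} (r u : ℕ) (σ : Vec (Fin n) m) →
  hessenbergPermᵇ r u σ ≡ true → u ≤ r → injectiveᵇ σ ≡ true
hessenbergPerm⇒injective r u [] _ _ = refl
hessenbergPerm⇒injective r u (x ∷ σ) accept u≤r with hessenbergPerm-cases r u x σ accept
... | inj₁ (x≡u , accept′) =
  ∧-true-intro (allᵇ-mono σ (hessenbergPerm⇒unused (suc r) (suc r) σ accept′ NP.≤-refl) fresh)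
               (hessenbergPerm⇒injective (suc r) (suc r) σ accept′ NP.≤-refl)
  where
  fresh : ∀ y → unusedᵇ (suc r) (suc r) y ≡ true → not ⌊ x ≟ᶠ y ⌋ ≡ true
  fresh y unused = ≢⇒≟ᶠ-false x y (apart (unused-cases (suc r) (suc r) y unused))
    where
    apart : (toℕ y ≡ suc r) ⊎ (suc r < toℕ y) → toℕ x ≢ toℕ y
    apart (inj₁ y≡r+1) x≡y = NP.<-irrefl refl (NP.≤-trans (NP.≤-reflexive (trans (sym y≡r+1) (trans (sym x≡y) x≡u))) u≤r)
    apart (inj₂ r+1<y) x≡y = NP.<-irrefl (trans (sym x≡u) x≡y) (NP.≤-<-trans u≤r (NP.<-trans (NP.n<1+n r) r+1<y))
... | inj₂ (x≢u , x≡r+1 , accept′) =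
  ∧-true-intro (allᵇ-mono σ (hessenbergPerm⇒unused (suc r) u σ accept′ (NP.m≤n⇒m≤1+n u≤r)) fresh)
               (hessenbergPerm⇒injective (suc r) u σ accept′ (NP.m≤n⇒m≤1+n u≤r))
  where
  fresh : ∀ y → unusedᵇ (suc r) u y ≡ true → not ⌊ x ≟ᶠ y ⌋ ≡ true
  fresh y unused = ≢⇒≟ᶠ-false x y (apart (unused-cases (suc r) u y unused))
    where
    apart : (toℕ y ≡ u) ⊎ (suc r < toℕ y) → toℕ x ≢ toℕ y
    apart (inj₁ y≡u)   x≡y = x≢u (trans x≡y y≡u)
    apart (inj₂ r+1<y) x≡y = NP.<-irrefl (trans (sym x≡r+1) x≡y) r+1<y

injective⇒hessenbergPerm : {n m : ℕ} (r u : ℕ) (σ : Vec (Fin n) m) → hessenbergShapeᵇ r σ ≡ true →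
  allᵇ (unusedᵇ r u) σ ≡ true → u ≤ r → injectiveᵇ σ ≡ true → hessenbergPermᵇ r u σ ≡ true
injective⇒hessenbergPerm r u [] _ _ _ _ = refl
injective⇒hessenbergPerm r u (x ∷ σ) shape unused u≤r inj = byCase (toℕ x ℕ.≟ u)
  where
  shape′ = hessenbergShape-cases r u x σ shape
  unused′ = ∧-true-split {unusedᵇ r u x} unused
  inj′ = ∧-true-split {notElemᵇ x σ} inj
  byCase : Dec (toℕ x ≡ u) → hessenbergPermᵇ r u (x ∷ σ) ≡ true
  byCase (yes x≡u) = trans (hessenbergPerm-gap r u x σ x≡u)
      (injective⇒hessenbergPerm (suc r) (suc r) σ (proj₂ shape′)
         (allᵇ-zip σ (proj₂ unused′) (proj₁ inj′) stillUnused) NP.≤-refl (proj₂ inj′))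
    where
    stillUnused : ∀ y → unusedᵇ r u y ≡ true → not ⌊ x ≟ᶠ y ⌋ ≡ true → unusedᵇ (suc r) (suc r) y ≡ true
    stillUnused y unused-y x≢y with unused-cases r u y unused-y
    ... | inj₁ y≡u = ⊥-elim (≟ᶠ-false x y x≢y (trans x≡u (sym y≡u)))
    ... | inj₂ r<y with NP.m≤n⇒m<n∨m≡n r<y
    ...   | inj₁ r+1<y = unused-beyond (suc r) (suc r) y r+1<y
    ...   | inj₂ r+1≡y = unused-gap (suc r) (suc r) y (sym r+1≡y)
  byCase (no x≢u) = trans (hessenbergPerm-next r u x σ x≢u x≡r+1)
      (injective⇒hessenbergPerm (suc r) u σ (proj₂ shape′)
         (allᵇ-zip σ (proj₂ unused′) (proj₁ inj′) stillUnused) (NP.m≤n⇒m≤1+n u≤r) (proj₂ inj′))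
    where
    x≡r+1 : toℕ x ≡ suc r
    x≡r+1 with unused-cases r u x (proj₁ unused′)
    ... | inj₁ x≡u = ⊥-elim (x≢u x≡u)
    ... | inj₂ r<x = NP.≤-antisym (proj₁ shape′) r<x
    stillUnused : ∀ y → unusedᵇ r u y ≡ true → not ⌊ x ≟ᶠ y ⌋ ≡ true → unusedᵇ (suc r) u y ≡ true
    stillUnused y unused-y x≢y with unused-cases r u y unused-y
    ... | inj₁ y≡u = unused-gap (suc r) u y y≡u
    ... | inj₂ r<y with NP.m≤n⇒m<n∨m≡n r<y
    ...   | inj₁ r+1<y = unused-beyond (suc r) u y r+1<y
    ...   | inj₂ r+1≡y = ⊥-elim (≟ᶠ-false x y x≢y (trans x≡r+1 r+1≡y))

isPerm≡hessenbergPerm : {n : ℕ} (σ : Vec (Fin n) n) → hessenbergShapeᵇ 0 σ ≡ true → isPerm σ ≡ hessenbergPermᵇ 0 0 σ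
isPerm≡hessenbergPerm σ shape =
  trans (pairwiseDistinct≡injective σ)
        (Bool-ext (injective⇒hessenbergPerm 0 0 σ shape (allᵇ-all _ σ unused-initially) z≤n)
                  (λ accept → hessenbergPerm⇒injective 0 0 σ accept z≤n))

-- Row expansion of Hessenberg matrices

entry : (s : ℤ) (ω : ℕ → ℤ) {k : ℕ} (t : Fin k → ℤ) (n : ℕ) → ℕ → ℕ → ℤ
entry s ω t n r c =
  if suc r ≡ᵇ n then ω (suc n ∸ suc c) * tExt t (suc n ∸ suc c)
  else if suc c ℕ.≤ᵇ suc r then tExt t (suc (suc r) ∸ suc c)
  else if suc c ≡ᵇ suc (suc r) then s
  else + 0

module _ (s : ℤ) (ω : ℕ → ℤ) {k : ℕ} (t : Fin k → ℤ) (n : ℕ) where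

  entry-last : ∀ r c → suc r ≡ n → entry s ω t n r c ≡ ω (n ∸ c) * tExt t (n ∸ c)
  entry-last r c r+1≡n = if-true (≡ᵇ-true (suc r) n r+1≡n)

  entry-below : ∀ r c → suc r < n → c ≤ r → entry s ω t n r c ≡ tExt t (suc r ∸ c)
  entry-below r c r+1<n c≤r =
    trans (if-false (≡ᵇ-false (suc r) n (λ r+1≡n → NP.<-irrefl r+1≡n r+1<n))) (if-true (<ᵇ-true c (suc r) (s≤s c≤r)))

  entry-super : ∀ r → suc r < n → entry s ω t n r (suc r) ≡ s
  entry-super r r+1<n =
    trans (if-false (≡ᵇ-false (suc r) n (λ r+1≡n → NP.<-irrefl r+1≡n r+1<n)))
      (trans (if-false (<ᵇ-false (suc r) (suc r) (NP.<-irrefl refl))) (if-true (≡ᵇ-true (suc r) (suc r) refl)))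

  entry-above : ∀ r c → suc r < c → c < n → entry s ω t n r c ≡ + 0
  entry-above r c r+1<c c<n =
    trans (if-false (≡ᵇ-false (suc r) n (λ r+1≡n → NP.<-asym r+1<c (subst (c <_) (sym r+1≡n) c<n))))
      (trans (if-false (<ᵇ-false c (suc r) (λ c<r+1 → NP.<-asym c<r+1 r+1<c)))
             (if-false (≡ᵇ-false c (suc r) (λ c≡r+1 → NP.<-irrefl (sym c≡r+1) r+1<c))))

entry-lower : (s s′ : ℤ) (ω : ℕ → ℤ) {k : ℕ} (t : Fin k → ℤ) (n : ℕ) →
  ∀ r c → c ≤ r → entry s ω t n r c ≡ entry s′ ω t n r c
entry-lower s s′ ω t n r c c≤r with suc r ≡ᵇ n
... | true  = refl
... | false = trans (if-true (<ᵇ-true c (suc r) (s≤s c≤r))) (sym (if-true (<ᵇ-true c (suc r) (s≤s c≤r))))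

prodTab : {m : ℕ} → (Fin m → ℤ) → ℤ
prodTab f = prodℤ (Vec.tabulate f)

prodTab-cong : {m : ℕ} (f g : Fin m → ℤ) → (∀ i → f i ≡ g i) → prodTab f ≡ prodTab g
prodTab-cong {zero}  f g f≡g = refl
prodTab-cong {suc m} f g f≡g = cong₂ _*_ (f≡g Fin.zero) (prodTab-cong (f ∘ Fin.suc) (g ∘ Fin.suc) (f≡g ∘ Fin.suc))

diagFrom : {n m : ℕ} → (ℕ → ℕ → ℤ) → ℕ → Vec (Fin n) m → ℤ
diagFrom h r []      = + 1
diagFrom h r (x ∷ σ) = h r (toℕ x) * diagFrom h (suc r) σ

prodTab≡diagFrom : {n m : ℕ} (h : ℕ → ℕ → ℤ) (r : ℕ) (σ : Vec (Fin n) m) →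
  prodTab (λ i → h (r ℕ.+ toℕ i) (toℕ (lookup σ i))) ≡ diagFrom h r σ
prodTab≡diagFrom h r [] = refl
prodTab≡diagFrom h r (x ∷ σ) = cong₂ _*_ (cong (λ z → h z (toℕ x)) (NP.+-identityʳ r))
  (trans (prodTab-cong _ (λ i → h (suc r ℕ.+ toℕ i) (toℕ (lookup σ i)))
                       (λ i → cong (λ z → h z (toℕ (lookup σ i))) (NP.+-suc r (toℕ i))))
         (prodTab≡diagFrom h (suc r) σ))

diagProd≡diagFrom : (s : ℤ) (ω : ℕ → ℤ) {k : ℕ} (t : Fin k → ℤ) (n : ℕ) (σ : Vec (Fin n) n) →
  diagProd (H s ω t n) σ ≡ diagFrom (entry s ω t n) 0 σ
diagProd≡diagFrom s ω t n σ = prodTab≡diagFrom (entry s ω t n) 0 σ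

diagFrom-offShape : (s : ℤ) (ω : ℕ → ℤ) {k : ℕ} (t : Fin k → ℤ) (n : ℕ) {m : ℕ} (r : ℕ) (σ : Vec (Fin n) m) →
  hessenbergShapeᵇ r σ ≡ false → diagFrom (entry s ω t n) r σ ≡ + 0
diagFrom-offShape s ω t n r [] ()
diagFrom-offShape s ω t n r (x ∷ σ) offShape with toℕ x ℕ.≤? suc r
... | yes _ = trans (cong (entry s ω t n r (toℕ x) *_) (diagFrom-offShape s ω t n (suc r) σ offShape))
                    (ℤP.*-zeroʳ (entry s ω t n r (toℕ x)))
... | no x≰r+1 = trans (cong (_* diagFrom (entry s ω t n) (suc r) σ) (entry-above s ω t n r (toℕ x) (NP.≰⇒> x≰r+1) (FinP.toℕ<n x)))
                       (ℤP.*-zeroˡ (diagFrom (entry s ω t n) (suc r) σ))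

sumℤ-indicator : (n c : ℕ) (a : ℤ) →
  sumℤ (map (λ (x : Fin n) → if toℕ x ≡ᵇ c then a else + 0) (allFin n)) ≡ (if c <ᵇ n then a else + 0)
sumℤ-indicator zero c a = refl
sumℤ-indicator (suc n) c a rewrite tabulate-suc n =
  trans (cong (_+_ (if 0 ≡ᵇ c then a else + 0)) (sumℤ-map-∘ _ Fin.suc (allFin n))) (byCase c)
  where
  byCase : ∀ c → (if 0 ≡ᵇ c then a else + 0) + sumℤ (map (λ x → if suc (toℕ x) ≡ᵇ c then a else + 0) (allFin n))
                 ≡ (if c <ᵇ suc n then a else + 0)
  byCase zero    = trans (cong (_+_ a) (sumℤ-zero _ (λ _ → refl) (allFin n))) (ℤP.+-identityʳ a)
  byCase (suc c) = trans (ℤP.+-identityˡ _) (sumℤ-indicator n c a)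

sumℤ-if-*ˡ : {A : Set} (c : ℤ) (p : A → Bool) (f : A → ℤ) (xs : List A) →
  sumℤ (map (λ x → if p x then c * f x else + 0) xs) ≡ c * sumℤ (map (λ x → if p x then f x else + 0) xs)
sumℤ-if-*ˡ c p f xs = trans (sumℤ-cong (λ x → pull (p x)) xs) (sumℤ-*ˡ c _ xs)
  where
  pull : ∀ b {d} → (if b then c * d else + 0) ≡ c * (if b then d else + 0)
  pull true  = refl
  pull false = sym (ℤP.*-zeroʳ c)

module _ {n : ℕ} (h : ℕ → ℕ → ℤ) where

  hessenbergSum : ℕ → ℕ → ℕ → ℤ
  hessenbergSum r u m = sumℤ (map (λ σ → if hessenbergPermᵇ r u σ then diagFrom h r σ else + 0) (allVecs n m))

  hessenbergExpansion : ℕ → ℕ → ℕ → ℤ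
  hessenbergExpansion r u zero    = + 1
  hessenbergExpansion r u (suc m) =
      (if u <ᵇ n then h r u * hessenbergExpansion (suc r) (suc r) m else + 0)
    + (if suc r <ᵇ n then h r (suc r) * hessenbergExpansion (suc r) u m else + 0)

  hessenbergSum-row : ∀ (r u m : ℕ) → u ≤ r → (x : Fin n) →
    sumℤ (map (λ σ → if hessenbergPermᵇ r u (x ∷ σ) then h r (toℕ x) * diagFrom h (suc r) σ else + 0) (allVecs n m))
    ≡ (if toℕ x ≡ᵇ u then h r u * hessenbergSum (suc r) (suc r) m else + 0)
      + (if toℕ x ≡ᵇ suc r then h r (suc r) * hessenbergSum (suc r) u m else + 0)
  hessenbergSum-row r u m u≤r x = byCase (toℕ x ℕ.≟ u) (toℕ x ℕ.≟ suc r)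
    where
    rowTerm : (Vec (Fin n) m → Bool) → Vec (Fin n) m → ℤ
    rowTerm accept σ = if accept σ then h r (toℕ x) * diagFrom h (suc r) σ else + 0
    rowTerms-cong : {a b : Vec (Fin n) m → Bool} → (∀ σ → a σ ≡ b σ) →
      sumℤ (map (rowTerm a) (allVecs n m)) ≡ sumℤ (map (rowTerm b) (allVecs n m))
    rowTerms-cong a≡b = sumℤ-cong (λ σ → cong (λ z → if z then h r (toℕ x) * diagFrom h (suc r) σ else + 0) (a≡b σ)) (allVecs n m)
    byCase : Dec (toℕ x ≡ u) → Dec (toℕ x ≡ suc r) → _
    byCase (yes x≡u) _ = begin
      _ ≡⟨ rowTerms-cong (λ σ → hessenbergPerm-gap r u x σ x≡u) ⟩
      _ ≡⟨ sumℤ-if-*ˡ (h r (toℕ x)) (hessenbergPermᵇ (suc r) (suc r)) (diagFrom h (suc r)) (allVecs n m) ⟩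
      h r (toℕ x) * hessenbergSum (suc r) (suc r) m ≡⟨ cong (λ z → h r z * hessenbergSum (suc r) (suc r) m) x≡u ⟩
      h r u * hessenbergSum (suc r) (suc r) m       ≡⟨ sym (ℤP.+-identityʳ _) ⟩
      _ ≡⟨ cong₂ _+_ (sym (if-true (≡ᵇ-true (toℕ x) u x≡u)))
                     (sym (if-false (≡ᵇ-false (toℕ x) (suc r) (λ x≡r+1 → NP.<-irrefl (trans (sym x≡u) x≡r+1) (s≤s u≤r))))) ⟩
      _ ∎
    byCase (no x≢u) (yes x≡r+1) = begin
      _ ≡⟨ rowTerms-cong (λ σ → hessenbergPerm-next r u x σ x≢u x≡r+1) ⟩
      _ ≡⟨ sumℤ-if-*ˡ (h r (toℕ x)) (hessenbergPermᵇ (suc r) u) (diagFrom h (suc r)) (allVecs n m) ⟩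
      h r (toℕ x) * hessenbergSum (suc r) u m       ≡⟨ cong (λ z → h r z * hessenbergSum (suc r) u m) x≡r+1 ⟩
      h r (suc r) * hessenbergSum (suc r) u m       ≡⟨ sym (ℤP.+-identityˡ _) ⟩
      _ ≡⟨ cong₂ _+_ (sym (if-false (≡ᵇ-false (toℕ x) u x≢u))) (sym (if-true (≡ᵇ-true (toℕ x) (suc r) x≡r+1))) ⟩
      _ ∎
    byCase (no x≢u) (no x≢r+1) = begin
      _ ≡⟨ rowTerms-cong (λ σ → hessenbergPerm-other r u x σ x≢u x≢r+1) ⟩
      _ ≡⟨ sumℤ-zero _ (λ _ → refl) (allVecs n m) ⟩
      + 0 ≡⟨ sym (cong₂ _+_ (if-false (≡ᵇ-false (toℕ x) u x≢u)) (if-false (≡ᵇ-false (toℕ x) (suc r) x≢r+1))) ⟩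
      _ ∎

  hessenbergSum≡expansion : ∀ m r u → u ≤ r → hessenbergSum r u m ≡ hessenbergExpansion r u m
  hessenbergSum≡expansion zero r u u≤r = refl
  hessenbergSum≡expansion (suc m) r u u≤r = begin
    hessenbergSum r u (suc m)
      ≡⟨ sumℤ-concatMap _ (λ x → map (x ∷_) (allVecs n m)) (allFin n) ⟩
    _ ≡⟨ sumℤ-cong (λ x → sumℤ-map-∘ _ (x ∷_) (allVecs n m)) (allFin n) ⟩
    _ ≡⟨ sumℤ-cong (hessenbergSum-row r u m u≤r) (allFin n) ⟩
    _ ≡⟨ sumℤ-+ _ _ (allFin n) ⟩
    _ ≡⟨ cong₂ _+_ (sumℤ-indicator n u _) (sumℤ-indicator n (suc r) _) ⟩
    _ ≡⟨ cong₂ _+_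
           (cong (λ z → if u <ᵇ n then h r u * z else + 0) (hessenbergSum≡expansion m (suc r) (suc r) NP.≤-refl))
           (cong (λ z → if suc r <ᵇ n then h r (suc r) * z else + 0) (hessenbergSum≡expansion m (suc r) u (NP.m≤n⇒m≤1+n u≤r))) ⟩
    hessenbergExpansion r u (suc m) ∎

countᵇ-below-unused : {n m : ℕ} (r u c : ℕ) (σ : Vec (Fin n) m) → allᵇ (unusedᵇ r u) σ ≡ true → u ≤ r → c ≤ u →
  countᵇ (λ y → toℕ y <ᵇ c) σ ≡ 0
countᵇ-below-unused r u c [] _ _ _ = refl
countᵇ-below-unused r u c (y ∷ σ) unused u≤r c≤u with ∧-true-split {unusedᵇ r u y} unused
... | unused-y , unused-σ =
  trans (cong (ℕ._+ countᵇ (λ y → toℕ y <ᵇ c) σ) (if-false (<ᵇ-false (toℕ y) c y≮c)))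
        (countᵇ-below-unused r u c σ unused-σ u≤r c≤u)
  where
  y≮c : ¬ (toℕ y < c)
  y≮c y<c with unused-cases r u y unused-y
  ... | inj₁ y≡u = NP.<-irrefl refl (NP.<-≤-trans y<c (subst (c ≤_) (sym y≡u) c≤u))
  ... | inj₂ r<y = NP.<-asym y<c (NP.≤-<-trans c≤u (NP.≤-<-trans u≤r r<y))

countᵇ-below-gap : {n m : ℕ} (r u c : ℕ) (σ : Vec (Fin n) m) → hessenbergPermᵇ r u σ ≡ true → u ≤ r →
  r ℕ.+ m ≡ n → r < n → u < c → c ≤ suc r → countᵇ (λ y → toℕ y <ᵇ c) σ ≡ 1
countᵇ-below-gap r u c [] _ _ len r<n _ _ = ⊥-elim (NP.<-irrefl (trans (sym (NP.+-identityʳ r)) len) r<n)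
countᵇ-below-gap {n} {suc m} r u c (x ∷ σ) accept u≤r len r<n u<c c≤r+1 with hessenbergPerm-cases r u x σ accept
... | inj₁ (x≡u , accept′) =
  cong₂ ℕ._+_ (if-true (<ᵇ-true (toℕ x) c (subst (_< c) (sym x≡u) u<c)))
              (countᵇ-below-unused (suc r) (suc r) c σ (hessenbergPerm⇒unused (suc r) (suc r) σ accept′ NP.≤-refl) NP.≤-refl c≤r+1)
... | inj₂ (_ , x≡r+1 , accept′) =
  trans (cong (ℕ._+ countᵇ (λ y → toℕ y <ᵇ c) σ)
              (if-false (<ᵇ-false (toℕ x) c (λ x<c → NP.<-irrefl refl (NP.<-≤-trans x<c (subst (c ≤_) (sym x≡r+1) c≤r+1))))))
        (countᵇ-below-gap (suc r) u c σ accept′ (NP.m≤n⇒m≤1+n u≤r) (trans (sym (NP.+-suc r m)) len)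
                          (subst (_< n) x≡r+1 (FinP.toℕ<n x)) u<c (NP.m≤n⇒m≤1+n c≤r+1))

-- Each row that takes the superdiagonal value r + 1 while the gap u is still open contributes
-- one factor −1 from H₋ and exactly one inversion (with the later row that takes u).
sign-cancels : (ω : ℕ → ℤ) {k : ℕ} (t : Fin k → ℤ) (n : ℕ) {m : ℕ} (r u : ℕ) (σ : Vec (Fin n) m) →
  hessenbergPermᵇ r u σ ≡ true → u ≤ r → r ℕ.+ m ≡ n →
  (- + 1) ^ inversionCount σ * diagFrom (entry (- + 1) ω t n) r σ ≡ diagFrom (entry (+ 1) ω t n) r σ
sign-cancels ω t n r u [] _ _ _ = refl
sign-cancels ω t n {suc m} r u (x ∷ σ) accept u≤r len with hessenbergPerm-cases r u x σ accept
... | inj₁ (x≡u , accept′) = begin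
    (- + 1) ^ (countᵇ (λ y → toℕ y <ᵇ toℕ x) σ ℕ.+ inversionCount σ) * (h₋ * D₋)
      ≡⟨ cong (λ z → (- + 1) ^ (z ℕ.+ inversionCount σ) * (h₋ * D₋)) noInversion ⟩
    ε * (h₋ * D₋) ≡⟨ cong (λ z → ε * (z * D₋)) (entry-lower (- + 1) (+ 1) ω t n r (toℕ x) (subst (_≤ r) (sym x≡u) u≤r)) ⟩
    ε * (h₊ * D₋) ≡⟨ ℤ*.x∙yz≈y∙xz ε h₊ D₋ ⟩
    h₊ * (ε * D₋) ≡⟨ cong (h₊ *_) (sign-cancels ω t n (suc r) (suc r) σ accept′ NP.≤-refl (trans (sym (NP.+-suc r m)) len)) ⟩
    h₊ * diagFrom (entry (+ 1) ω t n) (suc r) σ ∎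
  where
  ε = (- + 1) ^ inversionCount σ
  h₋ = entry (- + 1) ω t n r (toℕ x)
  h₊ = entry (+ 1) ω t n r (toℕ x)
  D₋ = diagFrom (entry (- + 1) ω t n) (suc r) σ
  noInversion : countᵇ (λ y → toℕ y <ᵇ toℕ x) σ ≡ 0
  noInversion = countᵇ-below-unused (suc r) (suc r) (toℕ x) σ (hessenbergPerm⇒unused (suc r) (suc r) σ accept′ NP.≤-refl)
                                    NP.≤-refl (subst (_≤ suc r) (sym x≡u) (NP.m≤n⇒m≤1+n u≤r))
... | inj₂ (_ , x≡r+1 , accept′) = begin
    (- + 1) ^ (countᵇ (λ y → toℕ y <ᵇ toℕ x) σ ℕ.+ inversionCount σ) * (h₋ * D₋)
      ≡⟨ cong₂ (λ a b → (- + 1) ^ (a ℕ.+ inversionCount σ) * (b * D₋)) oneInversion (trans (cong (entry (- + 1) ω t n r) x≡r+1) (entry-super (- + 1) ω t n r r+1<n)) ⟩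
    (- + 1) * ε * ((- + 1) * D₋) ≡⟨ signs ε D₋ ⟩
    ε * D₋                       ≡⟨ sign-cancels ω t n (suc r) u σ accept′ (NP.m≤n⇒m≤1+n u≤r) (trans (sym (NP.+-suc r m)) len) ⟩
    diagFrom (entry (+ 1) ω t n) (suc r) σ
      ≡⟨ sym (ℤP.*-identityˡ _) ⟩
    + 1 * diagFrom (entry (+ 1) ω t n) (suc r) σ
      ≡⟨ cong (_* diagFrom (entry (+ 1) ω t n) (suc r) σ) (sym (trans (cong (entry (+ 1) ω t n r) x≡r+1) (entry-super (+ 1) ω t n r r+1<n))) ⟩
    entry (+ 1) ω t n r (toℕ x) * diagFrom (entry (+ 1) ω t n) (suc r) σ ∎
  where
  ε = (- + 1) ^ inversionCount σ
  h₋ = entry (- + 1) ω t n r (toℕ x)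
  D₋ = diagFrom (entry (- + 1) ω t n) (suc r) σ
  r+1<n : suc r < n
  r+1<n = subst (_< n) x≡r+1 (FinP.toℕ<n x)
  oneInversion : countᵇ (λ y → toℕ y <ᵇ toℕ x) σ ≡ 1
  oneInversion = countᵇ-below-gap (suc r) u (toℕ x) σ accept′ (NP.m≤n⇒m≤1+n u≤r) (trans (sym (NP.+-suc r m)) len) r+1<n
                                   (subst (u <_) (sym x≡r+1) (s≤s u≤r)) (NP.m≤n⇒m≤1+n (NP.≤-reflexive x≡r+1))
  signs : ∀ a b → (- + 1) * a * ((- + 1) * b) ≡ a * b
  signs = solve-∀

module _ (ω : ℕ → ℤ) {k : ℕ} (t : Fin k → ℤ) (n : ℕ) where

  private
    h₊ = entry (+ 1) ω t n

    permTerm : (σ : Vec (Fin n) n) →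
      (if isPerm σ then diagProd (Hplus ω t n) σ else + 0) ≡ (if hessenbergPermᵇ 0 0 σ then diagFrom h₊ 0 σ else + 0)
    permTerm σ rewrite diagProd≡diagFrom (+ 1) ω t n σ with hessenbergShapeᵇ 0 σ in shape
    ... | true  = cong (λ b → if b then diagFrom h₊ 0 σ else + 0) (isPerm≡hessenbergPerm σ shape)
    ... | false rewrite diagFrom-offShape (+ 1) ω t n 0 σ shape = trans (if-eta (isPerm σ)) (sym (if-eta (hessenbergPermᵇ 0 0 σ)))

    detTerm : (σ : Vec (Fin n) n) →
      (if isPerm σ then sign σ * diagProd (Hminus ω t n) σ else + 0) ≡ (if hessenbergPermᵇ 0 0 σ then diagFrom h₊ 0 σ else + 0)
    detTerm σ rewrite diagProd≡diagFrom (- + 1) ω t n σ | pairInversions≡inversionCount σ with hessenbergShapeᵇ 0 σ in shape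
    ... | false rewrite diagFrom-offShape (- + 1) ω t n 0 σ shape | diagFrom-offShape (+ 1) ω t n 0 σ shape
                      | ℤP.*-zeroʳ ((- + 1) ^ inversionCount σ) = trans (if-eta (isPerm σ)) (sym (if-eta (hessenbergPermᵇ 0 0 σ)))
    ... | true rewrite isPerm≡hessenbergPerm σ shape with hessenbergPermᵇ 0 0 σ in accept
    ...   | true  = sign-cancels ω t n 0 0 σ accept z≤n refl
    ...   | false = refl

  perm-Hplus≡expansion : perm (Hplus ω t n) ≡ hessenbergExpansion {n} (entry (+ 1) ω t n) 0 0 n
  perm-Hplus≡expansion =
    trans (sumℤ-filterᵇ isPerm _ (allVecs n n)) (trans (sumℤ-cong permTerm (allVecs n n)) (hessenbergSum≡expansion h₊ n 0 0 z≤n))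

  det-Hminus≡expansion : det (Hminus ω t n) ≡ hessenbergExpansion {n} (entry (+ 1) ω t n) 0 0 n
  det-Hminus≡expansion =
    trans (sumℤ-filterᵇ isPerm _ (allVecs n n)) (trans (sumℤ-cong detTerm (allVecs n n)) (hessenbergSum≡expansion h₊ n 0 0 z≤n))

-- Dependence on the lag of the gap

module _ (ω : ℕ → ℤ) {k : ℕ} (t : Fin k → ℤ) where

  private
    τ : ℕ → ℤ
    τ = tExt t

  -- lagExpansion d e is the expansion of the last e + 1 rows when the gap lags the current row by d
  lagExpansion : ℕ → ℕ → ℤ
  lagExpansion d zero    = ω (suc d) * τ (suc d)
  lagExpansion d (suc e) = τ (suc d) * lagExpansion 0 e + lagExpansion (suc d) e

  hessenbergExpansion≡lagExpansion : (n : ℕ) → ∀ e r u → u ≤ r → r ℕ.+ suc e ≡ n →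
    hessenbergExpansion {n} (entry (+ 1) ω t n) r u (suc e) ≡ lagExpansion (r ∸ u) e
  hessenbergExpansion≡lagExpansion n zero r u u≤r len = begin
    (if u <ᵇ n then h r u * + 1 else + 0) + (if suc r <ᵇ n then _ else + 0)
      ≡⟨ cong₂ _+_ (if-true (<ᵇ-true u n u<n)) (if-false (<ᵇ-false (suc r) n (NP.<-irrefl r+1≡n))) ⟩
    h r u * + 1 + + 0            ≡⟨ trans (ℤP.+-identityʳ _) (ℤP.*-identityʳ _) ⟩
    h r u                        ≡⟨ entry-last (+ 1) ω t n r u r+1≡n ⟩
    ω (n ∸ u) * τ (n ∸ u)        ≡⟨ cong (λ z → ω z * τ z) n∸u≡ ⟩
    lagExpansion (r ∸ u) zero    ∎
    where
    h = entry (+ 1) ω t n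
    r+1≡n : suc r ≡ n
    r+1≡n = trans (NP.+-comm 1 r) len
    u<n : u < n
    u<n = subst (u <_) r+1≡n (s≤s u≤r)
    n∸u≡ : n ∸ u ≡ suc (r ∸ u)
    n∸u≡ = trans (cong (_∸ u) (sym r+1≡n)) (NP.+-∸-assoc 1 u≤r)
  hessenbergExpansion≡lagExpansion n (suc e) r u u≤r len = begin
    (if u <ᵇ n then h r u * E (suc r) (suc r) else + 0) + (if suc r <ᵇ n then h r (suc r) * E (suc r) u else + 0)
      ≡⟨ cong₂ _+_ (if-true (<ᵇ-true u n u<n)) (if-true (<ᵇ-true (suc r) n r+1<n)) ⟩
    h r u * E (suc r) (suc r) + h r (suc r) * E (suc r) u
      ≡⟨ cong₂ _+_ (cong₂ _*_ (entry-below (+ 1) ω t n r u r+1<n u≤r) (hessenbergExpansion≡lagExpansion n e (suc r) (suc r) NP.≤-refl len′))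
                   (cong₂ _*_ (entry-super (+ 1) ω t n r r+1<n) (hessenbergExpansion≡lagExpansion n e (suc r) u (NP.m≤n⇒m≤1+n u≤r) len′)) ⟩
    τ (suc r ∸ u) * lagExpansion (suc r ∸ suc r) e + + 1 * lagExpansion (suc r ∸ u) e
      ≡⟨ cong₂ _+_ (cong₂ (λ a b → τ a * lagExpansion b e) r+1∸u≡ (NP.n∸n≡0 r))
                   (trans (ℤP.*-identityˡ _) (cong (λ a → lagExpansion a e) r+1∸u≡)) ⟩
    lagExpansion (r ∸ u) (suc e) ∎
    where
    h = entry (+ 1) ω t n
    E : ℕ → ℕ → ℤ
    E r′ u′ = hessenbergExpansion {n} h r′ u′ (suc e)
    len′ : suc r ℕ.+ suc e ≡ n
    len′ = trans (sym (NP.+-suc r (suc e))) len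
    r+1<n : suc r < n
    r+1<n = subst (suc r <_) (trans (sym (trans (NP.+-suc r (suc e)) (cong suc (NP.+-suc r e)))) len) (s≤s (s≤s (NP.m≤m+n r e)))
    u<n : u < n
    u<n = NP.<-trans (s≤s u≤r) r+1<n
    r+1∸u≡ : suc r ∸ u ≡ suc (r ∸ u)
    r+1∸u≡ = NP.+-∸-assoc 1 u≤r

  lagExpansion-unfold : ∀ d e → lagExpansion d e
    ≡ ω (suc (d ℕ.+ e)) * τ (suc (d ℕ.+ e)) + sumBelow (λ i → τ (suc (d ℕ.+ i)) * lagExpansion 0 (e ∸ suc i)) e
  lagExpansion-unfold d zero =
    trans (cong (λ z → ω (suc z) * τ (suc z)) (sym (NP.+-identityʳ d))) (sym (ℤP.+-identityʳ _))
  lagExpansion-unfold d (suc e) = begin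
    a + lagExpansion (suc d) e ≡⟨ cong (_+_ a) (lagExpansion-unfold (suc d) e) ⟩
    a + (b + c)                ≡⟨ ℤ+.x∙yz≈y∙xz a b c ⟩
    b + (a + c)                ≡⟨ cong₂ (λ x y → x + (y + c)) (cong (λ z → ω (suc z) * τ (suc z)) (sym (NP.+-suc d e)))
                                                            (cong (λ z → τ (suc z) * lagExpansion 0 e) (sym (NP.+-identityʳ d))) ⟩
    b′ + (τ (suc (d ℕ.+ 0)) * lagExpansion 0 e + c)
                               ≡⟨ cong (λ z → b′ + (τ (suc (d ℕ.+ 0)) * lagExpansion 0 e + z))
                                       (sumBelow-cong _ _ e (λ i _ → cong (λ z → τ (suc z) * lagExpansion 0 (e ∸ suc i)) (sym (NP.+-suc d i)))) ⟩
    b′ + sumBelow (λ i → τ (suc (d ℕ.+ i)) * lagExpansion 0 (suc e ∸ suc i)) (suc e) ∎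
    where
    a = τ (suc d) * lagExpansion 0 e
    b = ω (suc (suc d ℕ.+ e)) * τ (suc (suc d ℕ.+ e))
    b′ = ω (suc (d ℕ.+ suc e)) * τ (suc (d ℕ.+ suc e))
    c = sumBelow (λ i → τ (suc (suc d ℕ.+ i)) * lagExpansion 0 (e ∸ suc i)) e

  lagExpansion-unique : (Q : ℕ → ℤ) → Q 0 ≡ + 0 →
    (∀ e → Q (suc e) ≡ ω (suc e) * τ (suc e) + sumBelow (λ i → τ (suc i) * Q (e ∸ i)) (suc e)) →
    ∀ e → lagExpansion 0 e ≡ Q (suc e)
  lagExpansion-unique Q Q0 Qrec = <-rec (λ e → lagExpansion 0 e ≡ Q (suc e)) step
    where
    step : ∀ e → (∀ {i} → i < e → lagExpansion 0 i ≡ Q (suc i)) → lagExpansion 0 e ≡ Q (suc e)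
    step e IH = begin
      lagExpansion 0 e
        ≡⟨ lagExpansion-unfold 0 e ⟩
      ω (suc e) * τ (suc e) + sumBelow (λ i → τ (suc i) * lagExpansion 0 (e ∸ suc i)) e
        ≡⟨ cong (_+_ (ω (suc e) * τ (suc e))) (sumBelow-cong _ _ e earlier) ⟩
      ω (suc e) * τ (suc e) + sumBelow (λ i → τ (suc i) * Q (e ∸ i)) e
        ≡⟨ cong (_+_ (ω (suc e) * τ (suc e))) (sym lastTermVanishes) ⟩
      ω (suc e) * τ (suc e) + sumBelow (λ i → τ (suc i) * Q (e ∸ i)) (suc e)
        ≡⟨ sym (Qrec e) ⟩
      Q (suc e) ∎
      where
      earlier : ∀ i → i < e → τ (suc i) * lagExpansion 0 (e ∸ suc i) ≡ τ (suc i) * Q (e ∸ i)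
      earlier i i<e = cong (τ (suc i) *_)
        (trans (IH (NP.∸-monoʳ-< (s≤s z≤n) i<e)) (cong Q (sym (NP.+-∸-assoc 1 i<e))))
      lastTermVanishes : sumBelow (λ i → τ (suc i) * Q (e ∸ i)) (suc e) ≡ sumBelow (λ i → τ (suc i) * Q (e ∸ i)) e
      lastTermVanishes = begin
        sumBelow (λ i → τ (suc i) * Q (e ∸ i)) (suc e)           ≡⟨ sumBelow-snoc _ e ⟩
        sumBelow (λ i → τ (suc i) * Q (e ∸ i)) e + τ (suc e) * Q (e ∸ e)
          ≡⟨ cong (λ z → sumBelow (λ i → τ (suc i) * Q (e ∸ i)) e + τ (suc e) * Q z) (NP.n∸n≡0 e) ⟩
        sumBelow (λ i → τ (suc i) * Q (e ∸ i)) e + τ (suc e) * Q 0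
          ≡⟨ cong (λ z → sumBelow (λ i → τ (suc i) * Q (e ∸ i)) e + τ (suc e) * z) Q0 ⟩
        sumBelow (λ i → τ (suc i) * Q (e ∸ i)) e + τ (suc e) * + 0
          ≡⟨ cong (_+_ (sumBelow (λ i → τ (suc i) * Q (e ∸ i)) e)) (ℤP.*-zeroʳ (τ (suc e))) ⟩
        sumBelow (λ i → τ (suc i) * Q (e ∸ i)) e + + 0           ≡⟨ ℤP.+-identityʳ _ ⟩
        sumBelow (λ i → τ (suc i) * Q (e ∸ i)) e                 ∎

boundedᵇ : {k : ℕ} → ℕ → Vec ℕ k → Bool
boundedᵇ B []      = true
boundedᵇ B (a ∷ β) = (a ≤ᵇ B) ∧ boundedᵇ B β

-- α − eᵢ; where αᵢ = 0 it returns α itself (truncated pred)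
decAt : {k : ℕ} → Fin k → Vec ℕ k → Vec ℕ k
decAt Fin.zero    (a ∷ β) = pred a ∷ β
decAt (Fin.suc i) (a ∷ β) = a ∷ decAt i β

positiveAt : {k : ℕ} → Fin k → Vec ℕ k → Bool
positiveAt i α = 0 <ᵇ lookup α i

boxSum : (k B : ℕ) → (Vec ℕ k → ℤ) → ℤ
boxSum k B g = sumℤ (map g (box k B))

boxSum-cons : (k B : ℕ) (g : Vec ℕ (suc k) → ℤ) →
  boxSum (suc k) B g ≡ sumBelow (λ a → boxSum k B (λ β → g (a ∷ β))) (suc B)
boxSum-cons k B g =
  trans (sumℤ-concatMap g (λ a → map (a ∷_) (box k B)) (upTo (suc B)))
    (trans (sumℤ-cong (λ a → sumℤ-map-∘ g (a ∷_) (box k B)) (upTo (suc B)))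
           (sumℤ-applyUpTo (λ a → boxSum k B (λ β → g (a ∷ β))) (λ x → x) (suc B)))

VanishesOutside : {k : ℕ} → ℕ → (Vec ℕ k → ℤ) → Set
VanishesOutside B g = ∀ β → boundedᵇ B β ≡ false → g β ≡ + 0

vanishesOutside-cons : {k : ℕ} (B a : ℕ) (g : Vec ℕ (suc k) → ℤ) →
  VanishesOutside B g → VanishesOutside B (λ β → g (a ∷ β))
vanishesOutside-cons B a g vanish β unbounded =
  vanish (a ∷ β) (trans (cong ((a ≤ᵇ B) ∧_) unbounded) (BP.∧-zeroʳ (a ≤ᵇ B)))

vanishesOutside-head : {k : ℕ} (B a : ℕ) (g : Vec ℕ (suc k) → ℤ) →
  VanishesOutside B g → B < a → ∀ β → g (a ∷ β) ≡ + 0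
vanishesOutside-head B a g vanish B<a β =
  vanish (a ∷ β) (cong (_∧ boundedᵇ B β) (≤ᵇ-false a B (λ a≤B → NP.<-irrefl refl (NP.<-≤-trans B<a a≤B))))

boxSum-enlarge : (k B c : ℕ) (g : Vec ℕ k → ℤ) → VanishesOutside B g → boxSum k (B ℕ.+ c) g ≡ boxSum k B g
boxSum-enlarge zero B c g vanish = refl
boxSum-enlarge (suc k) B c g vanish = begin
  boxSum (suc k) (B ℕ.+ c) g
    ≡⟨ boxSum-cons k (B ℕ.+ c) g ⟩
  sumBelow (λ a → boxSum k (B ℕ.+ c) (λ β → g (a ∷ β))) (suc B ℕ.+ c)
    ≡⟨ sumBelow-tail _ (suc B) c (λ a B<a → sumℤ-zero _ (vanishesOutside-head B a g vanish B<a) (box k (B ℕ.+ c))) ⟩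
  sumBelow (λ a → boxSum k (B ℕ.+ c) (λ β → g (a ∷ β))) (suc B)
    ≡⟨ sumBelow-cong _ _ (suc B) (λ a _ → boxSum-enlarge k B c (λ β → g (a ∷ β)) (vanishesOutside-cons B a g vanish)) ⟩
  sumBelow (λ a → boxSum k B (λ β → g (a ∷ β))) (suc B)
    ≡⟨ sym (boxSum-cons k B g) ⟩
  boxSum (suc k) B g ∎

boxSum-suc : (k B : ℕ) (g : Vec ℕ k → ℤ) → VanishesOutside B g → boxSum k (suc B) g ≡ boxSum k B g
boxSum-suc k B g vanish = trans (cong (λ z → boxSum k z g) (NP.+-comm 1 B)) (boxSum-enlarge k B 1 g vanish)

boxSum-decAt : (k : ℕ) (i : Fin k) (B : ℕ) (g : Vec ℕ k → ℤ) → VanishesOutside B g →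
  boxSum k (suc B) (λ α → if positiveAt i α then g (decAt i α) else + 0) ≡ boxSum k B g
boxSum-decAt (suc k) Fin.zero B g vanish = begin
  boxSum (suc k) (suc B) (λ α → if positiveAt Fin.zero α then g (decAt Fin.zero α) else + 0)
    ≡⟨ boxSum-cons k (suc B) _ ⟩
  boxSum k (suc B) (λ β → + 0) + sumBelow (λ a → boxSum k (suc B) (λ β → g (a ∷ β))) (suc B)
    ≡⟨ cong₂ _+_ (sumℤ-zero _ (λ _ → refl) (box k (suc B)))
                 (sumBelow-cong _ _ (suc B) (λ a _ → boxSum-suc k B (λ β → g (a ∷ β)) (vanishesOutside-cons B a g vanish))) ⟩
  + 0 + sumBelow (λ a → boxSum k B (λ β → g (a ∷ β))) (suc B)
    ≡⟨ ℤP.+-identityˡ _ ⟩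
  sumBelow (λ a → boxSum k B (λ β → g (a ∷ β))) (suc B)
    ≡⟨ sym (boxSum-cons k B g) ⟩
  boxSum (suc k) B g ∎
boxSum-decAt (suc k) (Fin.suc i) B g vanish = begin
  boxSum (suc k) (suc B) (λ α → if positiveAt (Fin.suc i) α then g (decAt (Fin.suc i) α) else + 0)
    ≡⟨ boxSum-cons k (suc B) _ ⟩
  sumBelow row (suc (suc B))
    ≡⟨ sumBelow-snoc row (suc B) ⟩
  sumBelow row (suc B) + row (suc B)
    ≡⟨ cong₂ _+_ (sumBelow-cong _ _ (suc B) (λ a _ → boxSum-decAt k i B (λ β → g (a ∷ β)) (vanishesOutside-cons B a g vanish)))
                 (sumℤ-zero _ (λ β → trans (cong (λ z → if positiveAt i β then z else + 0)
                                                 (vanishesOutside-head B (suc B) g vanish NP.≤-refl (decAt i β)))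
                                          (if-eta (positiveAt i β)))
                            (box k (suc B))) ⟩
  sumBelow (λ a → boxSum k B (λ β → g (a ∷ β))) (suc B) + + 0
    ≡⟨ ℤP.+-identityʳ _ ⟩
  sumBelow (λ a → boxSum k B (λ β → g (a ∷ β))) (suc B)
    ≡⟨ sym (boxSum-cons k B g) ⟩
  boxSum (suc k) B g ∎
  where
  row : ℕ → ℤ
  row a = boxSum k (suc B) (λ β → if positiveAt i β then g (a ∷ decAt i β) else + 0)

weightedDegree : {k : ℕ} → (Fin k → ℕ) → Vec ℕ k → ℕ
weightedDegree w α = Vec.sum (Vec.tabulate (λ j → w j ℕ.* lookup α j))

isobaricWeight : {k : ℕ} → Fin k → ℕ
isobaricWeight j = suc (toℕ j)

weightedDegree-decAt : {k : ℕ} (w : Fin k → ℕ) (i : Fin k) (α : Vec ℕ k) → positiveAt i α ≡ true →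
  weightedDegree w α ≡ weightedDegree w (decAt i α) ℕ.+ w i
weightedDegree-decAt w Fin.zero (suc a ∷ β) _ =
  trans (cong (ℕ._+ weightedDegree (w ∘ Fin.suc) β) (NP.*-suc (w Fin.zero) a))
        (rotate (w Fin.zero) (w Fin.zero ℕ.* a) (weightedDegree (w ∘ Fin.suc) β))
  where
  rotate : ∀ x y z → x ℕ.+ y ℕ.+ z ≡ y ℕ.+ z ℕ.+ x
  rotate = ℕSolver.solve-∀
weightedDegree-decAt w (Fin.suc i) (a ∷ β) pos =
  trans (cong (w Fin.zero ℕ.* a ℕ.+_) (weightedDegree-decAt (w ∘ Fin.suc) i β pos)) (sym (NP.+-assoc (w Fin.zero ℕ.* a) _ _))

bounded-mono : {k : ℕ} (B B′ : ℕ) (β : Vec ℕ k) → boundedᵇ B β ≡ true → B ≤ B′ → boundedᵇ B′ β ≡ true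
bounded-mono B B′ [] _ _ = refl
bounded-mono B B′ (a ∷ β) bounded B≤B′ with ∧-true-split {a ≤ᵇ B} bounded
... | a≤B , rest = ∧-true-intro (≤ᵇ-true a B′ (NP.≤-trans (NP.≤ᵇ⇒≤ a B (Equivalence.from T-≡ a≤B)) B≤B′))
                                (bounded-mono B B′ β rest B≤B′)

bounded-weightedDegree : {k : ℕ} (w : Fin k → ℕ) → (∀ j → 1 ≤ w j) → (α : Vec ℕ k) → boundedᵇ (weightedDegree w α) α ≡ true
bounded-weightedDegree w w≥1 [] = refl
bounded-weightedDegree w w≥1 (a ∷ β) =
  ∧-true-intro (≤ᵇ-true a _ a≤deg)
    (bounded-mono _ _ β (bounded-weightedDegree (w ∘ Fin.suc) (w≥1 ∘ Fin.suc) β) (NP.m≤n+m _ (w Fin.zero ℕ.* a)))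
  where
  a≤deg : a ≤ w Fin.zero ℕ.* a ℕ.+ weightedDegree (w ∘ Fin.suc) β
  a≤deg = NP.≤-trans (NP.≤-trans (NP.≤-reflexive (sym (NP.*-identityˡ a))) (NP.*-monoˡ-≤ a (w≥1 Fin.zero))) (NP.m≤m+n _ _)

isoDeg-unbounded : {k : ℕ} (M : ℕ) (β : Vec ℕ k) → boundedᵇ M β ≡ false → (isoDeg β ≡ᵇ M) ≡ false
isoDeg-unbounded M β unbounded = ≡ᵇ-false (isoDeg β) M deg≢M
  where
  deg≢M : isoDeg β ≢ M
  deg≢M deg≡M with trans (sym unbounded) (subst (λ z → boundedᵇ z β ≡ true) deg≡M (bounded-weightedDegree isobaricWeight (λ _ → s≤s z≤n) β))
  ... | ()

isobaricSum : (k N : ℕ) → (Vec ℕ k → ℤ) → ℤ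
isobaricSum k N f = sumℤ (map f (Alphas k N))

isobaricSum≡boxSum : (k N : ℕ) (f : Vec ℕ k → ℤ) →
  isobaricSum k N f ≡ boxSum k N (λ α → if isoDeg α ≡ᵇ N then f α else + 0)
isobaricSum≡boxSum k N f = sumℤ-filterᵇ (λ α → isoDeg α ≡ᵇ N) f (box k N)

≡ᵇ-+-cancelʳ : ∀ x c y → (x ℕ.+ c ≡ᵇ c ℕ.+ y) ≡ (x ≡ᵇ y)
≡ᵇ-+-cancelʳ x c y with x ≡ᵇ y in eq
... | true  = ≡ᵇ-true _ _ (trans (cong (ℕ._+ c) (NP.≡ᵇ⇒≡ x y (Equivalence.from T-≡ eq))) (NP.+-comm y c))
... | false = ≡ᵇ-false _ _ (λ x+c≡c+y → x≢y (NP.+-cancelʳ-≡ c x y (trans x+c≡c+y (NP.+-comm c y))))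
  where
  x≢y : x ≢ y
  x≢y x≡y with trans (sym eq) (≡ᵇ-true x y x≡y)
  ... | ()

module _ (k : ℕ) (i : Fin k) (f : Vec ℕ k → ℤ) where

  private
    wᵢ = suc (toℕ i)

    onDegree : ℕ → Vec ℕ k → ℤ
    onDegree M β = if isoDeg β ≡ᵇ M then f β else + 0

    onDegree-vanishes : ∀ M B → M ≤ B → VanishesOutside B (onDegree M)
    onDegree-vanishes M B M≤B β unbounded with boundedᵇ M β in bounded
    ... | true with trans (sym (bounded-mono M B β bounded M≤B)) unbounded
    ...   | ()
    onDegree-vanishes M B M≤B β unbounded | false = cong (λ z → if z then f β else + 0) (isoDeg-unbounded M β bounded)

    shifted : ∀ M → isobaricSum k (wᵢ ℕ.+ M) (λ α → if positiveAt i α then f (decAt i α) else + 0) ≡ isobaricSum k M f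
    shifted M = begin
      isobaricSum k (wᵢ ℕ.+ M) _
        ≡⟨ isobaricSum≡boxSum k (wᵢ ℕ.+ M) _ ⟩
      boxSum k (suc (toℕ i ℕ.+ M)) _
        ≡⟨ sumℤ-cong onShiftedDegree (box k (suc (toℕ i ℕ.+ M))) ⟩
      boxSum k (suc (toℕ i ℕ.+ M)) (λ α → if positiveAt i α then onDegree M (decAt i α) else + 0)
        ≡⟨ boxSum-decAt k i (toℕ i ℕ.+ M) (onDegree M) (onDegree-vanishes M _ (NP.m≤n+m M (toℕ i))) ⟩
      boxSum k (toℕ i ℕ.+ M) (onDegree M)
        ≡⟨ cong (λ z → boxSum k z (onDegree M)) (NP.+-comm (toℕ i) M) ⟩
      boxSum k (M ℕ.+ toℕ i) (onDegree M)
        ≡⟨ boxSum-enlarge k M (toℕ i) (onDegree M) (onDegree-vanishes M M NP.≤-refl) ⟩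
      boxSum k M (onDegree M)
        ≡⟨ sym (isobaricSum≡boxSum k M f) ⟩
      isobaricSum k M f ∎
      where
      onShiftedDegree : ∀ α → (if isoDeg α ≡ᵇ wᵢ ℕ.+ M then (if positiveAt i α then f (decAt i α) else + 0) else + 0)
                              ≡ (if positiveAt i α then onDegree M (decAt i α) else + 0)
      onShiftedDegree α with positiveAt i α in pos
      ... | false = if-eta _
      ... | true  = cong (λ z → if z then f (decAt i α) else + 0)
                         (trans (cong (_≡ᵇ wᵢ ℕ.+ M) (weightedDegree-decAt isobaricWeight i α pos)) (≡ᵇ-+-cancelʳ (isoDeg (decAt i α)) wᵢ M))

  isobaricSum-decAt : ∀ N → isobaricSum k N (λ α → if positiveAt i α then f (decAt i α) else + 0)
                            ≡ (if wᵢ ≤ᵇ N then isobaricSum k (N ∸ wᵢ) f else + 0)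
  isobaricSum-decAt N = byCase (wᵢ ℕ.≤? N)
    where
    byCase : Dec (wᵢ ≤ N) → isobaricSum k N (λ α → if positiveAt i α then f (decAt i α) else + 0)
                            ≡ (if wᵢ ≤ᵇ N then isobaricSum k (N ∸ wᵢ) f else + 0)
    byCase (yes wᵢ≤N) = begin
      isobaricSum k N _             ≡⟨ cong (λ z → isobaricSum k z (λ α → if positiveAt i α then f (decAt i α) else + 0))
                                            (sym (NP.m+[n∸m]≡n wᵢ≤N)) ⟩
      isobaricSum k (wᵢ ℕ.+ (N ∸ wᵢ)) _ ≡⟨ shifted (N ∸ wᵢ) ⟩
      isobaricSum k (N ∸ wᵢ) f      ≡⟨ sym (if-true (≤ᵇ-true wᵢ N wᵢ≤N)) ⟩
      _                             ∎
    byCase (no wᵢ≰N) =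
      trans (isobaricSum≡boxSum k N _) (trans (sumℤ-zero _ tooSmall (box k N)) (sym (if-false (≤ᵇ-false wᵢ N wᵢ≰N))))
      where
      tooSmall : ∀ α → (if isoDeg α ≡ᵇ N then (if positiveAt i α then f (decAt i α) else + 0) else + 0) ≡ + 0
      tooSmall α with positiveAt i α in pos
      ... | false = if-eta _
      ... | true  = cong (λ z → if z then f (decAt i α) else + 0)
                         (≡ᵇ-false _ _ (λ deg≡N → wᵢ≰N (NP.≤-trans (NP.m≤n+m wᵢ _)
                                          (NP.≤-reflexive (trans (sym (weightedDegree-decAt isobaricWeight i α pos)) deg≡N)))))

allZeroᵇ : {k : ℕ} → Vec ℕ k → Bool
allZeroᵇ []      = true
allZeroᵇ (a ∷ β) = (a ≡ᵇ 0) ∧ allZeroᵇ β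

zeroIndicator : {k : ℕ} → Vec ℕ k → ℤ
zeroIndicator β = if allZeroᵇ β then + 1 else + 0

δ₀ : ℕ → ℤ
δ₀ M = if M ≡ᵇ 0 then + 1 else + 0

boxSum-allZero : (k B : ℕ) (c : ℤ) → boxSum k B (λ β → if allZeroᵇ β then c else + 0) ≡ c
boxSum-allZero zero B c = ℤP.+-identityʳ c
boxSum-allZero (suc k) B c =
  trans (boxSum-cons k B _)
    (trans (cong₂ _+_ (boxSum-allZero k B c) (sumBelow-zero _ B (λ a _ → sumℤ-zero _ (λ _ → refl) (box k B))))
           (ℤP.+-identityʳ c))

weightedDegree-allZero : {k : ℕ} (w : Fin k → ℕ) (β : Vec ℕ k) → allZeroᵇ β ≡ true → weightedDegree w β ≡ 0
weightedDegree-allZero w [] _ = refl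
weightedDegree-allZero w (zero ∷ β) zeros =
  trans (cong (ℕ._+ weightedDegree (w ∘ Fin.suc) β) (NP.*-zeroʳ (w Fin.zero))) (weightedDegree-allZero (w ∘ Fin.suc) β zeros)

monomial-allZero : {k : ℕ} (t : Fin k → ℤ) (β : Vec ℕ k) → allZeroᵇ β ≡ true → monomial t β ≡ + 1
monomial-allZero t [] _ = refl
monomial-allZero t (zero ∷ β) zeros = trans (ℤP.*-identityˡ _) (monomial-allZero (t ∘ Fin.suc) β zeros)

monomial-decAt : {k : ℕ} (t : Fin k → ℤ) (i : Fin k) (α : Vec ℕ k) → positiveAt i α ≡ true →
  monomial t α ≡ t i * monomial t (decAt i α)
monomial-decAt t Fin.zero (suc a ∷ β) _ = ℤP.*-assoc (t Fin.zero) (t Fin.zero ^ a) _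
monomial-decAt t (Fin.suc i) (a ∷ β) pos =
  trans (cong (t Fin.zero ^ a *_) (monomial-decAt (t ∘ Fin.suc) i β pos))
        (ℤ*.x∙yz≈y∙xz (t Fin.zero ^ a) (t (Fin.suc i)) (monomial (t ∘ Fin.suc) (decAt i β)))

isobaricSum-zeroIndicator : (k M : ℕ) (t : Fin k → ℤ) → isobaricSum k M (λ β → zeroIndicator β * monomial t β) ≡ δ₀ M
isobaricSum-zeroIndicator k M t =
  trans (isobaricSum≡boxSum k M _) (trans (sumℤ-cong onlyZero (box k M)) (boxSum-allZero k M _))
  where
  onlyZero : ∀ β → (if isoDeg β ≡ᵇ M then zeroIndicator β * monomial t β else + 0) ≡ (if allZeroᵇ β then δ₀ M else + 0)
  onlyZero β with allZeroᵇ β in zeros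
  ... | true rewrite weightedDegree-allZero isobaricWeight β zeros | monomial-allZero t β zeros = byCase M
    where
    byCase : ∀ M → (if 0 ≡ᵇ M then + 1 * + 1 else + 0) ≡ δ₀ M
    byCase zero    = refl
    byCase (suc _) = refl
  ... | false = if-eta _

tExt-noVars : (t : Fin 0 → ℤ) (m : ℕ) → tExt t m ≡ + 0
tExt-noVars t zero = refl
tExt-noVars t (suc m) with m ℕ.<? 0
... | no _ = refl

tExt-one : {k : ℕ} (t : Fin (suc k) → ℤ) → tExt t 1 ≡ t Fin.zero
tExt-one {k} t with 0 ℕ.<? suc k
... | yes _   = refl
... | no 0≮k+1 = ⊥-elim (0≮k+1 (s≤s z≤n))

tExt-suc : {k : ℕ} (t : Fin (suc k) → ℤ) (m : ℕ) → tExt t (suc (suc m)) ≡ tExt (t ∘ Fin.suc) (suc m)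
tExt-suc {k} t m with suc m ℕ.<? suc k | m ℕ.<? k
... | yes m+1<k+1 | yes m<k = cong t (FinP.toℕ-injective (trans (FinP.toℕ-fromℕ< m+1<k+1) (cong suc (sym (FinP.toℕ-fromℕ< m<k)))))
... | yes m+1<k+1 | no m≮k  = ⊥-elim (m≮k (NP.≤-pred m+1<k+1))
... | no m+1≮k+1 | yes m<k  = ⊥-elim (m+1≮k+1 (s≤s m<k))
... | no _ | no _ = refl

sumℤ-allFin≡sumBelow-tExt : (k : ℕ) (t : Fin k → ℤ) (e : ℕ) (φ : ℕ → ℤ) →
  sumℤ (map (λ i → if toℕ i <ᵇ suc e then t i * φ (toℕ i) else + 0) (allFin k)) ≡ sumBelow (λ i → tExt t (suc i) * φ i) (suc e)
sumℤ-allFin≡sumBelow-tExt zero t e φ =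
  sym (sumBelow-zero _ (suc e) (λ i _ → trans (cong (_* φ i) (tExt-noVars t (suc i))) (ℤP.*-zeroˡ (φ i))))
sumℤ-allFin≡sumBelow-tExt (suc k) t e φ rewrite tabulate-suc k =
  cong₂ _+_ (cong (_* φ 0) (sym (tExt-one t))) (trans (sumℤ-map-∘ _ Fin.suc (allFin k)) (rest e))
  where
  rest : ∀ e → sumℤ (map (λ i → if suc (toℕ i) <ᵇ suc e then t (Fin.suc i) * φ (suc (toℕ i)) else + 0) (allFin k))
               ≡ sumBelow (λ i → tExt t (suc (suc i)) * φ (suc i)) e
  rest zero    = sumℤ-zero _ (λ _ → refl) (allFin k)
  rest (suc e) = trans (sumℤ-allFin≡sumBelow-tExt k (t ∘ Fin.suc) e (φ ∘ suc))
                       (sumBelow-cong _ _ (suc e) (λ i _ → cong (_* φ (suc i)) (sym (tExt-suc t i))))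

-- Integral multinomial coefficients

-- binom a b = (a + b)! / (a! b!), defined by Pascal's rule so that it is visibly an integer
binom : ℕ → ℕ → ℕ
binom zero    b       = 1
binom (suc a) zero    = 1
binom (suc a) (suc b) = binom a (suc b) ℕ.+ binom (suc a) b

binom-factorial : ∀ a b → binom a b ℕ.* (a ! ℕ.* b !) ≡ (a ℕ.+ b) !
binom-factorial zero b = trans (NP.*-identityˡ _) (NP.+-identityʳ (b !))
binom-factorial (suc a) zero = trans (NP.*-identityˡ _) (trans (NP.*-identityʳ _) (cong _! (sym (NP.+-identityʳ (suc a)))))
binom-factorial (suc a) (suc b) = begin
  (X ℕ.+ Y) ℕ.* (suc a ℕ.* a ! ℕ.* (suc b ℕ.* b !))
    ≡⟨ split X Y (a !) (b !) a b ⟩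
  suc a ℕ.* (X ℕ.* (a ! ℕ.* (suc b ℕ.* b !))) ℕ.+ suc b ℕ.* (Y ℕ.* (suc a ℕ.* a ! ℕ.* b !))
    ≡⟨ cong₂ (λ u v → suc a ℕ.* u ℕ.+ suc b ℕ.* v) (trans (binom-factorial a (suc b)) (cong _! (NP.+-suc a b)))
                                                  (binom-factorial (suc a) b) ⟩
  suc a ℕ.* F ℕ.+ suc b ℕ.* F
    ≡⟨ collect a b F ⟩
  suc (suc (a ℕ.+ b)) ℕ.* F
    ≡⟨ cong (λ z → suc z ℕ.* z !) (sym (NP.+-suc a b)) ⟩
  (suc a ℕ.+ suc b) ! ∎
  where
  X = binom a (suc b)
  Y = binom (suc a) b
  F = (suc (a ℕ.+ b)) !
  split : ∀ X Y A B a b → (X ℕ.+ Y) ℕ.* (suc a ℕ.* A ℕ.* (suc b ℕ.* B))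
                        ≡ suc a ℕ.* (X ℕ.* (A ℕ.* (suc b ℕ.* B))) ℕ.+ suc b ℕ.* (Y ℕ.* (suc a ℕ.* A ℕ.* B))
  split = ℕSolver.solve-∀
  collect : ∀ a b F → suc a ℕ.* F ℕ.+ suc b ℕ.* F ≡ suc (suc (a ℕ.+ b)) ℕ.* F
  collect = ℕSolver.solve-∀

factorialProduct : {k : ℕ} → Vec ℕ k → ℕ
factorialProduct β = ℕprod (List.map _! (Vec.toList β))

multinomialℕ : {k : ℕ} → Vec ℕ k → ℕ
multinomialℕ []      = 1
multinomialℕ (a ∷ β) = binom a (norm β) ℕ.* multinomialℕ β

multinomialℕ-factorial : {k : ℕ} (β : Vec ℕ k) → multinomialℕ β ℕ.* factorialProduct β ≡ (norm β) !
multinomialℕ-factorial [] = refl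
multinomialℕ-factorial (a ∷ β) = begin
  binom a (norm β) ℕ.* multinomialℕ β ℕ.* (a ! ℕ.* factorialProduct β)
    ≡⟨ regroup (binom a (norm β)) (multinomialℕ β) (a !) (factorialProduct β) ⟩
  binom a (norm β) ℕ.* (a ! ℕ.* (multinomialℕ β ℕ.* factorialProduct β))
    ≡⟨ cong (λ z → binom a (norm β) ℕ.* (a ! ℕ.* z)) (multinomialℕ-factorial β) ⟩
  binom a (norm β) ℕ.* (a ! ℕ.* (norm β) !)
    ≡⟨ binom-factorial a (norm β) ⟩
  (a ℕ.+ norm β) ! ∎
  where
  regroup : ∀ x y z w → x ℕ.* y ℕ.* (z ℕ.* w) ≡ x ℕ.* (z ℕ.* (y ℕ.* w))
  regroup = ℕSolver.solve-∀

factorialProduct-decAt : {k : ℕ} (i : Fin k) (β : Vec ℕ k) → positiveAt i β ≡ true →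
  factorialProduct β ≡ lookup β i ℕ.* factorialProduct (decAt i β)
factorialProduct-decAt Fin.zero (suc a ∷ β) _ = NP.*-assoc (suc a) (a !) (factorialProduct β)
factorialProduct-decAt (Fin.suc i) (a ∷ β) pos =
  trans (cong (a ! ℕ.*_) (factorialProduct-decAt i β pos)) (ℕ*.x∙yz≈y∙xz (a !) (lookup β i) (factorialProduct (decAt i β)))

norm-decAt : {k : ℕ} (i : Fin k) (β : Vec ℕ k) → positiveAt i β ≡ true → norm β ≡ suc (norm (decAt i β))
norm-decAt Fin.zero (suc a ∷ β) _ = refl
norm-decAt (Fin.suc i) (a ∷ β) pos = trans (cong (a ℕ.+_) (norm-decAt i β pos)) (NP.+-suc a _)

sumℤ-lookup : {k : ℕ} (β : Vec ℕ k) → sumℤ (map (λ i → + lookup β i) (allFin k)) ≡ + norm β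
sumℤ-lookup [] = refl
sumℤ-lookup {suc k} (a ∷ β) rewrite tabulate-suc k =
  trans (cong (_+_ (+ a)) (trans (sumℤ-map-∘ _ Fin.suc (allFin k)) (sumℤ-lookup β))) (sym (ℤP.pos-+ a (norm β)))

allZero⇒norm≡0 : {k : ℕ} (β : Vec ℕ k) → allZeroᵇ β ≡ true → norm β ≡ 0
allZero⇒norm≡0 [] _ = refl
allZero⇒norm≡0 (zero ∷ β) zeros = allZero⇒norm≡0 β zeros

norm≡0⇒allZero : {k : ℕ} (β : Vec ℕ k) → norm β ≡ 0 → allZeroᵇ β ≡ true
norm≡0⇒allZero [] _ = refl
norm≡0⇒allZero (zero ∷ β) |β|≡0 = norm≡0⇒allZero β |β|≡0

factorialProduct-allZero : {k : ℕ} (β : Vec ℕ k) → allZeroᵇ β ≡ true → factorialProduct β ≡ 1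
factorialProduct-allZero [] _ = refl
factorialProduct-allZero (zero ∷ β) zeros = trans (NP.+-identityʳ _) (factorialProduct-allZero β zeros)

factorialProduct-positive : {k : ℕ} (β : Vec ℕ k) → 1 ≤ factorialProduct β
factorialProduct-positive [] = NP.≤-refl
factorialProduct-positive (a ∷ β) = NP.*-mono-≤ (NP.1≤n! a) (factorialProduct-positive β)

nonPositive⇒≡0 : {k : ℕ} (i : Fin k) (β : Vec ℕ k) → positiveAt i β ≡ false → lookup β i ≡ 0
nonPositive⇒≡0 i β _ with lookup β i
... | zero = refl

multinomialℕ-decAt : {k : ℕ} (i : Fin k) (β : Vec ℕ k) →
  (if positiveAt i β then + multinomialℕ (decAt i β) else + 0) * + factorialProduct β ≡ + (lookup β i ℕ.* (pred (norm β)) !)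
multinomialℕ-decAt i β with positiveAt i β in pos
... | false rewrite nonPositive⇒≡0 i β pos = refl
... | true = begin
  + multinomialℕ (decAt i β) * + factorialProduct β
    ≡⟨ sym (ℤP.pos-* (multinomialℕ (decAt i β)) (factorialProduct β)) ⟩
  + (multinomialℕ (decAt i β) ℕ.* factorialProduct β)
    ≡⟨ cong (λ z → + (multinomialℕ (decAt i β) ℕ.* z)) (factorialProduct-decAt i β pos) ⟩
  + (multinomialℕ (decAt i β) ℕ.* (lookup β i ℕ.* factorialProduct (decAt i β)))
    ≡⟨ cong +_ (ℕ*.x∙yz≈y∙xz (multinomialℕ (decAt i β)) (lookup β i) (factorialProduct (decAt i β))) ⟩
  + (lookup β i ℕ.* (multinomialℕ (decAt i β) ℕ.* factorialProduct (decAt i β)))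
    ≡⟨ cong (λ z → + (lookup β i ℕ.* z)) (multinomialℕ-factorial (decAt i β)) ⟩
  + (lookup β i ℕ.* (norm (decAt i β)) !)
    ≡⟨ cong (λ z → + (lookup β i ℕ.* (pred z) !)) (sym (norm-decAt i β pos)) ⟩
  + (lookup β i ℕ.* (pred (norm β)) !) ∎

zeroIndicator-factorial : {k : ℕ} (β : Vec ℕ k) →
  zeroIndicator β * + factorialProduct β + + norm β * + ((pred (norm β)) !) ≡ + ((norm β) !)
zeroIndicator-factorial β with allZeroᵇ β in zeros
... | true rewrite allZero⇒norm≡0 β zeros | factorialProduct-allZero β zeros = refl
... | false = byNorm (norm β) refl
  where
  byNorm : ∀ N → norm β ≡ N → + 0 * + factorialProduct β + + N * + ((pred N) !) ≡ + (N !)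
  byNorm zero |β|≡0 with trans (sym (norm≡0⇒allZero β |β|≡0)) zeros
  ... | ()
  byNorm (suc N) _ = trans (ℤP.+-identityˡ _) (sym (ℤP.pos-* (suc N) (N !)))

decAtMultinomialSum : {k : ℕ} → Vec ℕ k → ℤ
decAtMultinomialSum {k} β = sumℤ (map (λ i → if positiveAt i β then + multinomialℕ (decAt i β) else + 0) (allFin k))

decAtMultinomialSum-factorial : {k : ℕ} (β : Vec ℕ k) →
  decAtMultinomialSum β * + factorialProduct β ≡ + norm β * + ((pred (norm β)) !)
decAtMultinomialSum-factorial {k} β = begin
  decAtMultinomialSum β * + factorialProduct β
    ≡⟨ sym (sumℤ-*ʳ (+ factorialProduct β) _ (allFin k)) ⟩
  sumℤ (map (λ i → (if positiveAt i β then + multinomialℕ (decAt i β) else + 0) * + factorialProduct β) (allFin k))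
    ≡⟨ sumℤ-cong (λ i → trans (multinomialℕ-decAt i β) (ℤP.pos-* (lookup β i) _)) (allFin k) ⟩
  sumℤ (map (λ i → + lookup β i * + ((pred (norm β)) !)) (allFin k))
    ≡⟨ sumℤ-*ʳ _ (λ i → + lookup β i) (allFin k) ⟩
  sumℤ (map (λ i → + lookup β i) (allFin k)) * + ((pred (norm β)) !)
    ≡⟨ cong (_* + ((pred (norm β)) !)) (sumℤ-lookup β) ⟩
  + norm β * + ((pred (norm β)) !) ∎

-- Proved after multiplying both sides by ∏ⱼ βⱼ! ≠ 0.
multinomialℕ-rec : {k : ℕ} (β : Vec ℕ k) → + multinomialℕ β ≡ zeroIndicator β + decAtMultinomialSum β
multinomialℕ-rec β = ℤP.*-cancelʳ-≡ (+ multinomialℕ β) (zeroIndicator β + decAtMultinomialSum β) (+ factorialProduct β)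
    {{ℤ.≢-nonZero ∏!≢0}} (begin
  + multinomialℕ β * + factorialProduct β
    ≡⟨ sym (ℤP.pos-* (multinomialℕ β) (factorialProduct β)) ⟩
  + (multinomialℕ β ℕ.* factorialProduct β)
    ≡⟨ cong +_ (multinomialℕ-factorial β) ⟩
  + ((norm β) !)
    ≡⟨ sym (zeroIndicator-factorial β) ⟩
  zeroIndicator β * + factorialProduct β + + norm β * + ((pred (norm β)) !)
    ≡⟨ cong (_+_ (zeroIndicator β * + factorialProduct β)) (sym (decAtMultinomialSum-factorial β)) ⟩
  zeroIndicator β * + factorialProduct β + decAtMultinomialSum β * + factorialProduct β
    ≡⟨ sym (ℤP.*-distribʳ-+ (+ factorialProduct β) (zeroIndicator β) (decAtMultinomialSum β)) ⟩
  (zeroIndicator β + decAtMultinomialSum β) * + factorialProduct β ∎)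
  where
  ∏!≢0 : + factorialProduct β ≢ + 0
  ∏!≢0 ∏!≡0 = NP.<-irrefl (sym (ℤP.+-injective ∏!≡0)) (factorialProduct-positive β)

lookup-decAt-other : {k : ℕ} (i j : Fin k) (α : Vec ℕ k) → i ≢ j → lookup (decAt i α) j ≡ lookup α j
lookup-decAt-other Fin.zero    Fin.zero    (a ∷ α) i≢j = ⊥-elim (i≢j refl)
lookup-decAt-other Fin.zero    (Fin.suc j) (a ∷ α) _   = refl
lookup-decAt-other (Fin.suc i) Fin.zero    (a ∷ α) _   = refl
lookup-decAt-other (Fin.suc i) (Fin.suc j) (a ∷ α) i≢j = lookup-decAt-other i j α (i≢j ∘ cong Fin.suc)

decAt-comm : {k : ℕ} (i j : Fin k) (α : Vec ℕ k) → decAt i (decAt j α) ≡ decAt j (decAt i α)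
decAt-comm Fin.zero    Fin.zero    (a ∷ α) = refl
decAt-comm Fin.zero    (Fin.suc j) (a ∷ α) = refl
decAt-comm (Fin.suc i) Fin.zero    (a ∷ α) = refl
decAt-comm (Fin.suc i) (Fin.suc j) (a ∷ α) = cong (a ∷_) (decAt-comm i j α)

positiveAt-decAt-comm : {k : ℕ} (i j : Fin k) (α : Vec ℕ k) →
  positiveAt j α ∧ positiveAt i (decAt j α) ≡ positiveAt i α ∧ positiveAt j (decAt i α)
positiveAt-decAt-comm i j α with i FinP.≟ j
... | yes refl = refl
... | no i≢j = trans (cong (λ z → positiveAt j α ∧ (0 <ᵇ z)) (lookup-decAt-other j i α (i≢j ∘ sym)))
                (trans (BP.∧-comm (positiveAt j α) (positiveAt i α))
                       (cong (λ z → positiveAt i α ∧ (0 <ᵇ z)) (sym (lookup-decAt-other i j α i≢j))))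

if-∧ : ∀ (b c : Bool) (m : ℤ) → (if b then (if c then m else + 0) else + 0) ≡ (if b ∧ c then m else + 0)
if-∧ true  c m = refl
if-∧ false c m = refl

*-if : ∀ (c : ℤ) (b : Bool) (x : ℤ) → c * (if b then x else + 0) ≡ (if b then c * x else + 0)
*-if c true  x = refl
*-if c false x = ℤP.*-zeroʳ c

if-+ : ∀ (b : Bool) (x y : ℤ) → (if b then x + y else + 0) ≡ (if b then x else + 0) + (if b then y else + 0)
if-+ true  x y = refl
if-+ false x y = refl

module _ (ω : ℕ → ℤ) where

  -- the integer multinomial(α) · (Σⱼ ωⱼ αⱼ) / |α|, since multinomial(α) · αⱼ / |α| = M(α − eⱼ)
  weightedMultinomial : {k : ℕ} → Vec ℕ k → ℤ
  weightedMultinomial {k} α =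
    sumℤ (map (λ j → ω (suc (toℕ j)) * (if positiveAt j α then + multinomialℕ (decAt j α) else + 0)) (allFin k))

  weightedMultinomial-factorial : {k : ℕ} (α : Vec ℕ k) →
    weightedMultinomial α * + factorialProduct α ≡ weightSum ω α * + ((pred (norm α)) !)
  weightedMultinomial-factorial {k} α = begin
    weightedMultinomial α * + factorialProduct α
      ≡⟨ sym (sumℤ-*ʳ (+ factorialProduct α) _ (allFin k)) ⟩
    sumℤ (map (λ j → ω (suc (toℕ j)) * (if positiveAt j α then + multinomialℕ (decAt j α) else + 0) * + factorialProduct α) (allFin k))
      ≡⟨ sumℤ-cong term (allFin k) ⟩
    sumℤ (map (λ j → ω (suc (toℕ j)) * + lookup α j * + ((pred (norm α)) !)) (allFin k))
      ≡⟨ sumℤ-*ʳ _ (λ j → ω (suc (toℕ j)) * + lookup α j) (allFin k) ⟩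
    weightSum ω α * + ((pred (norm α)) !) ∎
    where
    term : ∀ j → ω (suc (toℕ j)) * (if positiveAt j α then + multinomialℕ (decAt j α) else + 0) * + factorialProduct α
               ≡ ω (suc (toℕ j)) * + lookup α j * + ((pred (norm α)) !)
    term j = begin
      ω (suc (toℕ j)) * _ * + factorialProduct α
        ≡⟨ ℤP.*-assoc (ω (suc (toℕ j))) _ (+ factorialProduct α) ⟩
      ω (suc (toℕ j)) * ((if positiveAt j α then + multinomialℕ (decAt j α) else + 0) * + factorialProduct α)
        ≡⟨ cong (ω (suc (toℕ j)) *_) (trans (multinomialℕ-decAt j α) (ℤP.pos-* (lookup α j) _)) ⟩
      ω (suc (toℕ j)) * (+ lookup α j * + ((pred (norm α)) !))
        ≡⟨ sym (ℤP.*-assoc (ω (suc (toℕ j))) (+ lookup α j) _) ⟩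
      ω (suc (toℕ j)) * + lookup α j * + ((pred (norm α)) !) ∎

  private
    ωᵢ : {k : ℕ} → Fin k → ℤ
    ωᵢ i = ω (suc (toℕ i))

    twiceDecremented : {k : ℕ} → Vec ℕ k → Fin k → Fin k → ℤ
    twiceDecremented α j i =
      ωᵢ j * (if positiveAt j α ∧ positiveAt i (decAt j α) then + multinomialℕ (decAt i (decAt j α)) else + 0)

    byFirstStep : {k : ℕ} (α : Vec ℕ k) (j : Fin k) →
      ωᵢ j * (if positiveAt j α then decAtMultinomialSum (decAt j α) else + 0) ≡ sumℤ (map (twiceDecremented α j) (allFin k))
    byFirstStep {k} α j = begin
      ωᵢ j * (if positiveAt j α then decAtMultinomialSum (decAt j α) else + 0)
        ≡⟨ cong (ωᵢ j *_) (sym (sumℤ-if (positiveAt j α) _ (allFin k))) ⟩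
      ωᵢ j * sumℤ (map (λ i → if positiveAt j α then (if positiveAt i (decAt j α) then + multinomialℕ (decAt i (decAt j α)) else + 0) else + 0) (allFin k))
        ≡⟨ sym (sumℤ-*ˡ (ωᵢ j) _ (allFin k)) ⟩
      sumℤ (map (λ i → ωᵢ j * (if positiveAt j α then (if positiveAt i (decAt j α) then + multinomialℕ (decAt i (decAt j α)) else + 0) else + 0)) (allFin k))
        ≡⟨ sumℤ-cong (λ i → cong (ωᵢ j *_) (if-∧ (positiveAt j α) _ _)) (allFin k) ⟩
      sumℤ (map (twiceDecremented α j) (allFin k)) ∎

    bySecondStep : {k : ℕ} (α : Vec ℕ k) (i : Fin k) →
      (if positiveAt i α then weightedMultinomial (decAt i α) else + 0) ≡ sumℤ (map (λ j → twiceDecremented α j i) (allFin k))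
    bySecondStep {k} α i = trans (sym (sumℤ-if (positiveAt i α) _ (allFin k))) (sumℤ-cong swapOrder (allFin k))
      where
      swapOrder : ∀ j → (if positiveAt i α then ωᵢ j * (if positiveAt j (decAt i α) then + multinomialℕ (decAt j (decAt i α)) else + 0) else + 0)
                        ≡ twiceDecremented α j i
      swapOrder j = begin
        _ ≡⟨ sym (*-if (ωᵢ j) (positiveAt i α) _) ⟩
        ωᵢ j * (if positiveAt i α then (if positiveAt j (decAt i α) then + multinomialℕ (decAt j (decAt i α)) else + 0) else + 0)
          ≡⟨ cong (ωᵢ j *_) (if-∧ (positiveAt i α) _ _) ⟩
        ωᵢ j * (if positiveAt i α ∧ positiveAt j (decAt i α) then + multinomialℕ (decAt j (decAt i α)) else + 0)
          ≡⟨ cong₂ (λ b z → ωᵢ j * (if b then + multinomialℕ z else + 0)) (sym (positiveAt-decAt-comm i j α)) (decAt-comm j i α) ⟩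
        twiceDecremented α j i ∎

  weightedMultinomial-rec : {k : ℕ} (α : Vec ℕ k) → weightedMultinomial α
    ≡ sumℤ (map (λ i → if positiveAt i α then ωᵢ i * zeroIndicator (decAt i α) + weightedMultinomial (decAt i α) else + 0) (allFin k))
  weightedMultinomial-rec {k} α = begin
    weightedMultinomial α
      ≡⟨ sumℤ-cong (λ j → cong (λ z → ωᵢ j * (if positiveAt j α then z else + 0)) (multinomialℕ-rec (decAt j α))) (allFin k) ⟩
    sumℤ (map (λ j → ωᵢ j * (if positiveAt j α then zeroIndicator (decAt j α) + decAtMultinomialSum (decAt j α) else + 0)) (allFin k))
      ≡⟨ sumℤ-cong (λ j → trans (cong (ωᵢ j *_) (if-+ (positiveAt j α) _ _)) (ℤP.*-distribˡ-+ (ωᵢ j) _ _)) (allFin k) ⟩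
    sumℤ (map (λ j → ωᵢ j * (if positiveAt j α then zeroIndicator (decAt j α) else + 0)
                   + ωᵢ j * (if positiveAt j α then decAtMultinomialSum (decAt j α) else + 0)) (allFin k))
      ≡⟨ sumℤ-+ _ _ (allFin k) ⟩
    sumℤ (map (λ j → ωᵢ j * (if positiveAt j α then zeroIndicator (decAt j α) else + 0)) (allFin k))
      + sumℤ (map (λ j → ωᵢ j * (if positiveAt j α then decAtMultinomialSum (decAt j α) else + 0)) (allFin k))
      ≡⟨ cong₂ _+_ (sumℤ-cong (λ j → *-if (ωᵢ j) (positiveAt j α) _) (allFin k)) doubleSum ⟩
    sumℤ (map (λ i → if positiveAt i α then ωᵢ i * zeroIndicator (decAt i α) else + 0) (allFin k))
      + sumℤ (map (λ i → if positiveAt i α then weightedMultinomial (decAt i α) else + 0) (allFin k))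
      ≡⟨ sym (sumℤ-+ _ _ (allFin k)) ⟩
    _ ≡⟨ sumℤ-cong (λ i → sym (if-+ (positiveAt i α) _ _)) (allFin k) ⟩
    _ ∎
    where
    doubleSum : sumℤ (map (λ j → ωᵢ j * (if positiveAt j α then decAtMultinomialSum (decAt j α) else + 0)) (allFin k))
              ≡ sumℤ (map (λ i → if positiveAt i α then weightedMultinomial (decAt i α) else + 0) (allFin k))
    doubleSum = trans (sumℤ-cong (byFirstStep α) (allFin k))
                      (trans (sumℤ-swap (twiceDecremented α) (allFin k) (allFin k)) (sym (sumℤ-cong (bySecondStep α) (allFin k))))

-- Recursion for the isobaric polynomial

module _ (ω : ℕ → ℤ) {k : ℕ} (t : Fin k → ℤ) where

  Pℤ : ℕ → ℤ
  Pℤ N = isobaricSum k N (λ α → weightedMultinomial ω α * monomial t α)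

  private
    ωᵢ : Fin k → ℤ
    ωᵢ i = ω (suc (toℕ i))

    stepTerm : Fin k → Vec ℕ k → ℤ
    stepTerm i β = t i * ((ωᵢ i * zeroIndicator β + weightedMultinomial ω β) * monomial t β)

    term-byLastVariable : ∀ α → weightedMultinomial ω α * monomial t α
                                ≡ sumℤ (map (λ i → if positiveAt i α then stepTerm i (decAt i α) else + 0) (allFin k))
    term-byLastVariable α = begin
      weightedMultinomial ω α * monomial t α
        ≡⟨ cong (_* monomial t α) (weightedMultinomial-rec ω α) ⟩
      sumℤ (map (λ i → if positiveAt i α then ωᵢ i * zeroIndicator (decAt i α) + weightedMultinomial ω (decAt i α) else + 0) (allFin k))
        * monomial t α
        ≡⟨ sym (sumℤ-*ʳ (monomial t α) _ (allFin k)) ⟩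
      _ ≡⟨ sumℤ-cong pullVariable (allFin k) ⟩
      _ ∎
      where
      pullVariable : ∀ i → (if positiveAt i α then ωᵢ i * zeroIndicator (decAt i α) + weightedMultinomial ω (decAt i α) else + 0) * monomial t α
                           ≡ (if positiveAt i α then stepTerm i (decAt i α) else + 0)
      pullVariable i with positiveAt i α in pos
      ... | false = ℤP.*-zeroˡ (monomial t α)
      ... | true  = trans (cong (coefficient *_) (monomial-decAt t i α pos)) (ℤ*.x∙yz≈y∙xz coefficient (t i) (monomial t (decAt i α)))
        where coefficient = ωᵢ i * zeroIndicator (decAt i α) + weightedMultinomial ω (decAt i α)

    isobaricSum-stepTerm : ∀ i M → isobaricSum k M (stepTerm i) ≡ t i * (ωᵢ i * δ₀ M + Pℤ M)
    isobaricSum-stepTerm i M = begin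
      isobaricSum k M (stepTerm i)
        ≡⟨ sumℤ-*ˡ (t i) _ (Alphas k M) ⟩
      t i * isobaricSum k M (λ β → (ωᵢ i * zeroIndicator β + weightedMultinomial ω β) * monomial t β)
        ≡⟨ cong (t i *_) (sumℤ-cong expand (Alphas k M)) ⟩
      t i * isobaricSum k M (λ β → ωᵢ i * (zeroIndicator β * monomial t β) + weightedMultinomial ω β * monomial t β)
        ≡⟨ cong (t i *_) (sumℤ-+ _ _ (Alphas k M)) ⟩
      t i * (isobaricSum k M (λ β → ωᵢ i * (zeroIndicator β * monomial t β)) + Pℤ M)
        ≡⟨ cong (λ z → t i * (z + Pℤ M)) (trans (sumℤ-*ˡ (ωᵢ i) _ (Alphas k M)) (cong (ωᵢ i *_) (isobaricSum-zeroIndicator k M t))) ⟩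
      t i * (ωᵢ i * δ₀ M + Pℤ M) ∎
      where
      expand : ∀ β → (ωᵢ i * zeroIndicator β + weightedMultinomial ω β) * monomial t β
                     ≡ ωᵢ i * (zeroIndicator β * monomial t β) + weightedMultinomial ω β * monomial t β
      expand β = trans (ℤP.*-distribʳ-+ (monomial t β) (ωᵢ i * zeroIndicator β) (weightedMultinomial ω β))
                       (cong (_+ weightedMultinomial ω β * monomial t β) (ℤP.*-assoc (ωᵢ i) (zeroIndicator β) (monomial t β)))

  Pℤ-byLastVariable : ∀ N → Pℤ N ≡ sumℤ (map (λ i → if suc (toℕ i) ≤ᵇ N
                                                  then t i * (ωᵢ i * δ₀ (N ∸ suc (toℕ i)) + Pℤ (N ∸ suc (toℕ i))) else + 0) (allFin k))
  Pℤ-byLastVariable N = begin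
    Pℤ N
      ≡⟨ sumℤ-cong term-byLastVariable (Alphas k N) ⟩
    isobaricSum k N (λ α → sumℤ (map (λ i → if positiveAt i α then stepTerm i (decAt i α) else + 0) (allFin k)))
      ≡⟨ sumℤ-swap (λ α i → if positiveAt i α then stepTerm i (decAt i α) else + 0) (Alphas k N) (allFin k) ⟩
    sumℤ (map (λ i → isobaricSum k N (λ α → if positiveAt i α then stepTerm i (decAt i α) else + 0)) (allFin k))
      ≡⟨ sumℤ-cong (λ i → trans (isobaricSum-decAt k i (stepTerm i) N)
                                 (cong (λ z → if suc (toℕ i) ≤ᵇ N then z else + 0) (isobaricSum-stepTerm i (N ∸ suc (toℕ i)))))
                    (allFin k) ⟩
    _ ∎

  Pℤ-zero : Pℤ 0 ≡ + 0
  Pℤ-zero = trans (Pℤ-byLastVariable 0) (sumℤ-zero _ (λ _ → refl) (allFin k))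

  Pℤ-rec : ∀ e → Pℤ (suc e) ≡ ω (suc e) * tExt t (suc e) + sumBelow (λ i → tExt t (suc i) * Pℤ (e ∸ i)) (suc e)
  Pℤ-rec e = begin
    Pℤ (suc e)
      ≡⟨ Pℤ-byLastVariable (suc e) ⟩
    _ ≡⟨ sumℤ-allFin≡sumBelow-tExt k t e (λ j → ω (suc j) * δ₀ (e ∸ j) + Pℤ (e ∸ j)) ⟩
    sumBelow (λ j → τ (suc j) * (ω (suc j) * δ₀ (e ∸ j) + Pℤ (e ∸ j))) (suc e)
      ≡⟨ sumBelow-cong _ _ (suc e) (λ j _ → ℤP.*-distribˡ-+ (τ (suc j)) (ω (suc j) * δ₀ (e ∸ j)) (Pℤ (e ∸ j))) ⟩
    sumBelow (λ j → τ (suc j) * (ω (suc j) * δ₀ (e ∸ j)) + τ (suc j) * Pℤ (e ∸ j)) (suc e)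
      ≡⟨ sumBelow-+ (λ j → τ (suc j) * (ω (suc j) * δ₀ (e ∸ j))) (λ j → τ (suc j) * Pℤ (e ∸ j)) (suc e) ⟩
    sumBelow (λ j → τ (suc j) * (ω (suc j) * δ₀ (e ∸ j))) (suc e) + sumBelow (λ j → τ (suc j) * Pℤ (e ∸ j)) (suc e)
      ≡⟨ cong (_+ sumBelow (λ j → τ (suc j) * Pℤ (e ∸ j)) (suc e)) onlyLastIsConstant ⟩
    ω (suc e) * τ (suc e) + sumBelow (λ j → τ (suc j) * Pℤ (e ∸ j)) (suc e) ∎
    where
    τ = tExt t
    onlyLastIsConstant : sumBelow (λ j → τ (suc j) * (ω (suc j) * δ₀ (e ∸ j))) (suc e) ≡ ω (suc e) * τ (suc e)
    onlyLastIsConstant = begin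
      sumBelow (λ j → τ (suc j) * (ω (suc j) * δ₀ (e ∸ j))) (suc e)
        ≡⟨ sumBelow-snoc _ e ⟩
      sumBelow (λ j → τ (suc j) * (ω (suc j) * δ₀ (e ∸ j))) e + τ (suc e) * (ω (suc e) * δ₀ (e ∸ e))
        ≡⟨ cong₂ _+_ (sumBelow-zero _ e earlier) (cong (λ z → τ (suc e) * (ω (suc e) * δ₀ z)) (NP.n∸n≡0 e)) ⟩
      + 0 + τ (suc e) * (ω (suc e) * + 1)
        ≡⟨ simplify (τ (suc e)) (ω (suc e)) ⟩
      ω (suc e) * τ (suc e) ∎
      where
      simplify : ∀ x w → + 0 + x * (w * + 1) ≡ w * x
      simplify = solve-∀
      earlier : ∀ j → j < e → τ (suc j) * (ω (suc j) * δ₀ (e ∸ j)) ≡ + 0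
      earlier j j<e = begin
        τ (suc j) * (ω (suc j) * δ₀ (e ∸ j))
          ≡⟨ cong (λ z → τ (suc j) * (ω (suc j) * z)) (if-false (≡ᵇ-false (e ∸ j) 0 (λ e∸j≡0 → NP.<⇒≱ j<e (NP.m∸n≡0⇒m≤n e∸j≡0)))) ⟩
        τ (suc j) * (ω (suc j) * + 0)
          ≡⟨ trans (cong (τ (suc j) *_) (ℤP.*-zeroʳ (ω (suc j)))) (ℤP.*-zeroʳ (τ (suc j))) ⟩
        + 0 ∎

toℚᵘ-/-suc : (a : ℤ) (d : ℕ) → ℚᵘ._≃_ (ℚ.toℚᵘ (a ℚ./ suc d)) (mkℚᵘ a d)
toℚᵘ-/-suc a d = ℚP.toℚᵘ-fromℚᵘ (mkℚᵘ a d)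

toℚ-+ : ∀ a b → toℚ (a + b) ≡ toℚ a ℚ.+ toℚ b
toℚ-+ a b = ℚP.toℚᵘ-injective (ℚᵘP.≃-trans (toℚᵘ-/-suc (a + b) 0) (ℚᵘP.≃-sym
  (ℚᵘP.≃-trans (ℚP.toℚᵘ-homo-+ (toℚ a) (toℚ b))
    (ℚᵘP.≃-trans (ℚᵘP.+-cong (toℚᵘ-/-suc a 0) (toℚᵘ-/-suc b 0)) (*≡* (unitDenominators a b))))))
  where
  unitDenominators : ∀ a b → (a * + 1 + b * + 1) * + 1 ≡ (a + b) * + 1
  unitDenominators = solve-∀

fractions-product : ∀ (a b c m : ℤ) (D N : ℕ) → a * b ≡ c * (+ suc D * + suc N) →
  (a ℚ./ suc D) ℚ.* (b ℚ./ suc N) ℚ.* toℚ m ≡ toℚ (c * m)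
fractions-product a b c m D N ab≡cDN = ℚP.toℚᵘ-injective (ℚᵘP.≃-trans viaℚᵘ (ℚᵘP.≃-sym (toℚᵘ-/-suc (c * m) 0)))
  where
  viaℚᵘ : ℚᵘ._≃_ (ℚ.toℚᵘ ((a ℚ./ suc D) ℚ.* (b ℚ./ suc N) ℚ.* toℚ m)) (mkℚᵘ (c * m) 0)
  viaℚᵘ = ℚᵘP.≃-trans (ℚP.toℚᵘ-homo-* ((a ℚ./ suc D) ℚ.* (b ℚ./ suc N)) (toℚ m))
          (ℚᵘP.≃-trans (ℚᵘP.*-cong (ℚᵘP.≃-trans (ℚP.toℚᵘ-homo-* (a ℚ./ suc D) (b ℚ./ suc N))
                                                  (ℚᵘP.*-cong (toℚᵘ-/-suc a D) (toℚᵘ-/-suc b N)))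
                                   (toℚᵘ-/-suc m 0))
          (*≡* (trans (dropUnit a b m) (trans (cong (_* m) ab≡cDN) (reorder c m (+ suc D) (+ suc N))))))
    where
    dropUnit : ∀ a b m → a * b * m * + 1 ≡ a * b * m
    dropUnit = solve-∀
    reorder : ∀ c m x y → c * (x * y) * m ≡ c * m * (x * y * + 1)
    reorder = solve-∀

sumℚ-filterᵇ-toℚ : {A : Set} (p : A → Bool) (f : A → ℚ) (g : A → ℤ) (xs : List A) →
  (∀ x → p x ≡ true → f x ≡ toℚ (g x)) → sumℚ (map f (filterᵇ p xs)) ≡ toℚ (sumℤ (map g (filterᵇ p xs)))
sumℚ-filterᵇ-toℚ p f g [] _ = refl
sumℚ-filterᵇ-toℚ p f g (x ∷ xs) f≡g with p x in px
... | true  = trans (cong₂ ℚ._+_ (f≡g x px) (sumℚ-filterᵇ-toℚ p f g xs f≡g)) (sym (toℚ-+ (g x) _))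
... | false = sumℚ-filterᵇ-toℚ p f g xs f≡g

module _ (ω : ℕ → ℤ) {k : ℕ} (t : Fin k → ℤ) where

  private
    P-term : (α : Vec ℕ k) (N D : ℕ) → norm α ≡ suc N → factorialProduct α ≡ suc D →
      multinomial α ℚ.* divq (weightSum ω α) (norm α) ℚ.* toℚ (monomial t α) ≡ toℚ (weightedMultinomial ω α * monomial t α)
    P-term α N D |α|≡ ∏!≡ rewrite |α|≡ | ∏!≡ =
      fractions-product (+ ((suc N) !)) (weightSum ω α) (weightedMultinomial ω α) (monomial t α) D N cleared
      where
      W∏!≡ : weightedMultinomial ω α * + suc D ≡ weightSum ω α * + (N !)
      W∏!≡ = trans (cong (λ z → weightedMultinomial ω α * + z) (sym ∏!≡))
                   (trans (weightedMultinomial-factorial ω α) (cong (λ z → weightSum ω α * + ((pred z) !)) |α|≡))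
      cleared : + ((suc N) !) * weightSum ω α ≡ weightedMultinomial ω α * (+ suc D * + suc N)
      cleared = begin
        + ((suc N) !) * weightSum ω α               ≡⟨ cong (_* weightSum ω α) (ℤP.pos-* (suc N) (N !)) ⟩
        + suc N * + (N !) * weightSum ω α           ≡⟨ reverse (+ suc N) (+ (N !)) (weightSum ω α) ⟩
        weightSum ω α * + (N !) * + suc N           ≡⟨ cong (_* + suc N) (sym W∏!≡) ⟩
        weightedMultinomial ω α * + suc D * + suc N ≡⟨ ℤP.*-assoc (weightedMultinomial ω α) (+ suc D) (+ suc N) ⟩
        weightedMultinomial ω α * (+ suc D * + suc N) ∎
        where
        reverse : ∀ a b c → a * b * c ≡ c * b * a
        reverse = solve-∀

    norm-positive : ∀ (α : Vec ℕ k) N → (isoDeg α ≡ᵇ suc N) ≡ true → Σ ℕ (λ N′ → norm α ≡ suc N′)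
    norm-positive α N deg≡N+1 with norm α in |α|≡
    ... | suc N′ = N′ , refl
    ... | zero with trans (sym (cong (_≡ᵇ suc N) (weightedDegree-allZero isobaricWeight α (norm≡0⇒allZero α |α|≡)))) deg≡N+1
    ...   | ()

    factorialProduct-suc : ∀ (α : Vec ℕ k) → Σ ℕ (λ D → factorialProduct α ≡ suc D)
    factorialProduct-suc α with factorialProduct α | factorialProduct-positive α
    ... | suc D | _ = D , refl

  P≡toℚ-Pℤ : ∀ N → P ω k (suc N) t ≡ toℚ (Pℤ ω t (suc N))
  P≡toℚ-Pℤ N = sumℚ-filterᵇ-toℚ (λ α → isoDeg α ≡ᵇ suc N) _ (λ α → weightedMultinomial ω α * monomial t α) (box k (suc N)) termwise
    where
    termwise : ∀ α → (isoDeg α ≡ᵇ suc N) ≡ true → _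
    termwise α deg≡N+1 with norm-positive α N deg≡N+1 | factorialProduct-suc α
    ... | N′ , |α|≡ | D , ∏!≡ = P-term α N′ D |α|≡ ∏!≡

theorem14 : (k n : ℕ) → 1 ≤ k → 1 ≤ n → (t : Fin k → ℤ) → (ω : ℕ → ℤ) →
    (toℚ (perm (Hplus ω t n)) ≡ P ω k n t) × (toℚ (det (Hminus ω t n)) ≡ P ω k n t)
theorem14 k (suc e) _ (s≤s z≤n) t ω =
  trans (cong toℚ perm≡Pℤ) P-integral , trans (cong toℚ det≡Pℤ) P-integral
  where
  expansion≡Pℤ : hessenbergExpansion {suc e} (entry (+ 1) ω t (suc e)) 0 0 (suc e) ≡ Pℤ ω t (suc e)
  expansion≡Pℤ = trans (hessenbergExpansion≡lagExpansion ω t (suc e) e 0 0 z≤n refl)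
                       (lagExpansion-unique ω t (Pℤ ω t) (Pℤ-zero ω t) (Pℤ-rec ω t) e)
  perm≡Pℤ : perm (Hplus ω t (suc e)) ≡ Pℤ ω t (suc e)
  perm≡Pℤ = trans (perm-Hplus≡expansion ω t (suc e)) expansion≡Pℤ
  det≡Pℤ : det (Hminus ω t (suc e)) ≡ Pℤ ω t (suc e)
  det≡Pℤ = trans (det-Hminus≡expansion ω t (suc e)) expansion≡Pℤ
  P-integral : toℚ (Pℤ ω t (suc e)) ≡ P ω k (suc e) t
  P-integral = sym (P≡toℚ-Pℤ ω t e)
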